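{- For any two hypergraphs $\mathcal{C}_1$ and $\mathcal{C}_2$ on disjoint vertex sets, $\psi(\mathcal{C}(\operatorname{Ind}(\mathcal{C}_1)*\operatorname{Ind}(\mathcal{C}_2)))=\psi(\mathcal{C}_1)+\psi(\mathcal{C}_2)$.
   Context: A hypergraph $\mathcal{C}$ on a finite vertex set $V$ is a family of pairwise incomparable subsets of $V$ (edges), each of cardinality at least $2$; isolated vertices allowed. $\operatorname{Ind}(\mathcal{C})$ is the simplicial complex on $V$ of subsets containing no edge. For a simplicial complex $\Delta$ on $V$ (containing all singletons), $\mathcal{C}(\Delta)$ is the hypergraph on $V$ of minimal non-faces of $\Delta$, so $\operatorname{Ind}(\mathcal{C}(\Delta))=\Delta$. $*$ denotes the simplicial join (on the disjoint union of the vertex sets). For an edge $F$: $\mathcal{C}-F$ has vertex set $V$ and edge set $\mathcal{C}\setminus\{F\}$; $N_{\mathcal{C}}(F)=\bigcup\{E\setminus F: E\in\mathcal{C},|E\setminus F|=1\}$; $\mathcal{C}:F$ is the hypergraph on $V\setminus(F\cup N_{\mathcal{C}}(F))$ whose edges are the inclusion-minimal sets among $\{E\setminus F:E\in\mathcal{C}-F\}$ of size at least $2$ (those meeting $N_{\mathcal{C}}(F)$ discarded). $\psi(\mathcal{C})\in\mathbb{Z}_{\ge0}\cup\{\infty\}$: $\psi=0$ if $V=\emptyset$; $\psi=\infty$ if $V\ne\emptyset$ and $\mathcal{C}=\emptyset$; otherwise $\psi(\mathcal{C})=\max_{F\in\mathcal{C}}\min\{\psi(\mathcal{C}-F),\psi(\mathcal{C}:F)+|F|-1\}$;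 with $\infty+a=\infty$. -}

module Defs where

open import Data.Nat using (ℕ; zero; suc; _+_; _∸_; _≤_; _≡ᵇ_; _<ᵇ_)
open import Data.Nat as N using ()
open import Data.Bool using (Bool; true; false; _∧_; _∨_; not; if_then_else_; T)
open import Data.List using (List; []; _∷_; _++_; map; length; filterᵇ; deduplicateᵇ; foldr; concat; lookup)
open import Data.Bool.ListAction using (any; all)
open import Data.List.Relation.Unary.All using (All)
open import Data.List.Relation.Unary.Unique.Propositional using (Unique)
open import Data.List.Relation.Binary.Subset.Propositional using (_⊆_)
open import Data.List.Membership.Propositional using (_∈_; _∉_)
open import Data.Fin using (Fin)
open import Data.Product using (_×_; _,_)
open import Relation.Binary.PropositionalEquality using (_≢_)
open import Relation.Nullary using (¬_)

data ℕ∞ : Set where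
  fin : ℕ → ℕ∞
  ∞   : ℕ∞

infixl 6 _+∞_
_+∞_ : ℕ∞ → ℕ∞ → ℕ∞
fin m +∞ fin n = fin (m + n)
_     +∞ _     = ∞

max∞ : ℕ∞ → ℕ∞ → ℕ∞
max∞ (fin m) (fin n) = fin (m N.⊔ n)
max∞ _ _ = ∞

min∞ : ℕ∞ → ℕ∞ → ℕ∞
min∞ (fin m) (fin n) = fin (m N.⊓ n)
min∞ (fin m) ∞ = fin m
min∞ ∞ y = y

_∈ᵇ_ : ℕ → List ℕ → Bool
x ∈ᵇ xs = any (x ≡ᵇ_) xs

_⊆ᵇ_ : List ℕ → List ℕ → Bool
xs ⊆ᵇ ys = all (_∈ᵇ ys) xs

_≐ᵇ_ : List ℕ → List ℕ → Bool
xs ≐ᵇ ys = (xs ⊆ᵇ ys) ∧ (ys ⊆ᵇ xs)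

_⊂ᵇ_ : List ℕ → List ℕ → Bool
xs ⊂ᵇ ys = (xs ⊆ᵇ ys) ∧ not (ys ⊆ᵇ xs)

_∖_ : List ℕ → List ℕ → List ℕ
xs ∖ ys = filterᵇ (λ x → not (x ∈ᵇ ys)) xs

meets : List ℕ → List ℕ → Bool
meets xs ys = any (_∈ᵇ ys) xs

subsets : List ℕ → List (List ℕ)
subsets [] = [] ∷ []
subsets (x ∷ xs) = subsets xs ++ map (x ∷_) (subsets xs)

record Hypergraph : Set where
  constructor hg
  field
    vertices : List ℕ
    edges    : List (List ℕ)
open Hypergraph public

record WF (C : Hypergraph) : Set where
  field
    vertices-unique : Unique (vertices C)
    edges-unique    : All Unique (edges C)
    edges-⊆         : All (_⊆ vertices C) (edges C)
    edges-size      : All (λ e → 2 ≤ length e) (edges C)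
    incomparable    : (i j : Fin (length (edges C))) → i ≢ j →
                      ¬ (lookup (edges C) i ⊆ lookup (edges C) j)

Disjoint : List ℕ → List ℕ → Set
Disjoint xs ys = ∀ x → x ∈ xs → x ∉ ys

record Complex : Set where
  constructor cx
  field
    cvertices : List ℕ
    isFace    : List ℕ → Bool
open Complex public

Ind : Hypergraph → Complex
Ind C = cx (vertices C) (λ S → (S ⊆ᵇ vertices C) ∧ not (any (λ e → e ⊆ᵇ S) (edges C)))

_*_ : Complex → Complex → Complex
Δ₁ * Δ₂ = cx (cvertices Δ₁ ++ cvertices Δ₂)
  (λ S → (S ⊆ᵇ (cvertices Δ₁ ++ cvertices Δ₂))
       ∧ isFace Δ₁ (filterᵇ (_∈ᵇ cvertices Δ₁) S)
       ∧ isFace Δ₂ (filterᵇ (_∈ᵇ cvertices Δ₂) S))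

minNonFaces : Complex → Hypergraph
minNonFaces Δ = hg (cvertices Δ) (filterᵇ isMin (subsets (cvertices Δ)))
  where
  isMin : List ℕ → Bool
  isMin S = not (isFace Δ S)
          ∧ all (λ T → not (T ⊂ᵇ S) ∨ isFace Δ T) (subsets (cvertices Δ))

picks : {A : Set} → List A → List (A × List A)
picks [] = []
picks (x ∷ xs) = (x , xs) ∷ map (λ { (y , ys) → (y , x ∷ ys) }) (picks xs)

minimalSets : List (List ℕ) → List (List ℕ)
minimalSets L = deduplicateᵇ _≐ᵇ_ (filterᵇ (λ S → not (any (_⊂ᵇ S) L)) L)

-- N_𝒞(F), where `rest` are the edges of 𝒞 - F
nbhd : List ℕ → List (List ℕ) → List ℕ
nbhd F rest = concat (filterᵇ (λ S → length S ≡ᵇ 1) (map (_∖ F) rest))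

colonV : List ℕ → List ℕ → List (List ℕ) → List ℕ
colonV V F rest = V ∖ (F ++ nbhd F rest)

colonE : List ℕ → List (List ℕ) → List (List ℕ)
colonE F rest =
  minimalSets (filterᵇ (λ S → (1 <ᵇ length S) ∧ not (meets S (nbhd F rest)))
                       (map (_∖ F) rest))

maxList : List ℕ∞ → ℕ∞
maxList = foldr max∞ (fin 0)

-- Both 𝒞 - F and 𝒞 : F have strictly fewer
-- edges than 𝒞, so fuel = number of edges always suffices (the fuel-0
-- clause with nonempty V and E is never reached from ψ below).
ψ-fuel : ℕ → List ℕ → List (List ℕ) → ℕ∞
ψ-fuel _ [] _ = fin 0
ψ-fuel _ (_ ∷ _) [] = ∞
ψ-fuel zero (_ ∷ _) (_ ∷ _) = ∞
ψ-fuel (suc k) V@(_ ∷ _) E@(_ ∷ _) = maxList (map step (picks E))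
  where
  step : List ℕ × List (List ℕ) → ℕ∞
  step (F , rest) = min∞ (ψ-fuel k V rest)
                         (ψ-fuel k (colonV V F rest) (colonE F rest) +∞ fin (length F ∸ 1))

ψ : Hypergraph → ℕ∞
ψ C = ψ-fuel (length (edges C)) (vertices C) (edges C)

-- The minimal non-faces of Ind C₁ * Ind C₂ are exactly the edges of C₁ and of C₂, so the
-- left-hand side is ψ of the disjoint union C₁ ⊔ C₂ (ψ only sees the edges as sets).
-- Additivity of ψ on disjoint unions goes by induction on the number of edges: for an edge
-- F of C₁, the edges of C₂ are disjoint from F and so leave N(F) unchanged, hence
-- (C₁ ⊔ C₂) - F = (C₁ - F) ⊔ C₂ and (C₁ ⊔ C₂) : F = (C₁ : F) ⊔ C₂. The branch of the
-- recursion at F is then min{ψ(C₁ - F), ψ(C₁ : F) + |F| - 1} + ψ(C₂), symmetrically for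
-- edges of C₂, and the maximum over all branches is ψ(C₁) + ψ(C₂). If C₁ has vertices but
-- no edges, ψ(C₁) = ∞ and every branch is ∞ as well.

module Submission where

open import Defs
open import Data.Nat using (ℕ; zero; suc; _+_; _∸_; _≤_; z≤n; s≤s; _<ᵇ_; _≡ᵇ_)
import Data.Nat.Properties as ℕₚ
open import Data.Bool using (Bool; true; false; T; _∧_; _∨_; not)
open import Data.Bool.Properties using (T?)
open import Data.Bool.ListAction using (any; all)
open import Data.Unit using (tt)
open import Data.Empty using (⊥-elim)
open import Data.Fin using (Fin; zero; suc)
import Data.Fin.Properties as Finₚ
open import Data.List using (List; []; _∷_; _++_; map; length; filterᵇ; deduplicate; lookup)
import Data.List.Properties as Listₚ
open import Data.List.Relation.Unary.All as All using (All; []; _∷_)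
import Data.List.Relation.Unary.All.Properties as Allₚ
open import Data.List.Relation.Unary.Any as Any using (here; there)
import Data.List.Relation.Unary.Any.Properties as Anyₚ
open import Data.List.Relation.Unary.AllPairs as AllPairs using (AllPairs; []; _∷_)
import Data.List.Relation.Unary.AllPairs.Properties as AllPairsₚ
open import Data.List.Relation.Unary.Unique.Propositional using (Unique)
import Data.List.Relation.Unary.Unique.Propositional.Properties as Uniqueₚ
open import Data.List.Relation.Binary.Subset.Propositional using (_⊆_)
import Data.List.Relation.Binary.Subset.Propositional.Properties as ⊆ₚ
open import Data.List.Membership.Propositional using (_∈_; _∉_; find; lose)
import Data.List.Membership.Propositional.Properties as ∈ₚ
open import Data.Product using (_×_; _,_; proj₁; proj₂; ∃; ∃₂)
open import Data.Sum using (_⊎_; inj₁; inj₂; [_,_]′; swap)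
open import Function using (_∘_; case_of_)
open import Relation.Binary.PropositionalEquality
  using (_≡_; _≢_; refl; sym; trans; cong; cong₂; subst; subst₂; module ≡-Reasoning)
open import Relation.Nullary using (¬_; ¬?; yes; no; Dec)

T-∧⁺ : ∀ {a b} → T a → T b → T (a ∧ b)
T-∧⁺ {true} {true} _ _ = tt

T-∧⁻ˡ : ∀ {a b} → T (a ∧ b) → T a
T-∧⁻ˡ {true} _ = tt

T-∧⁻ʳ : ∀ {a b} → T (a ∧ b) → T b
T-∧⁻ʳ {true} {true} _ = tt

T-not⁺ : ∀ {a} → ¬ T a → T (not a)
T-not⁺ {false} _ = tt
T-not⁺ {true} ¬t = ¬t tt

T-not⁻ : ∀ {a} → T (not a) → ¬ T a
T-not⁻ {false} _ ()
T-not⁻ {true} ()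

T-∨⁻ : ∀ {a b} → T (a ∨ b) → T a ⊎ T b
T-∨⁻ {true} _ = inj₁ tt
T-∨⁻ {false} {true} _ = inj₂ tt

T-∨⁺ˡ : ∀ {a b} → T a → T (a ∨ b)
T-∨⁺ˡ {true} _ = tt

T-∨⁺ʳ : ∀ {a b} → T b → T (a ∨ b)
T-∨⁺ʳ {true} _ = tt
T-∨⁺ʳ {false} t = t

module _ {A : Set} (p : A → Bool) where

  ∈-filterᵇ⁻ : ∀ {x xs} → x ∈ filterᵇ p xs → x ∈ xs × T (p x)
  ∈-filterᵇ⁻ = ∈ₚ.∈-filter⁻ (T? ∘ p)

  ∈-filterᵇ⁺ : ∀ {x xs} → x ∈ xs → T (p x) → x ∈ filterᵇ p xs
  ∈-filterᵇ⁺ = ∈ₚ.∈-filter⁺ (T? ∘ p)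

infix 4 _≋_ _⊂_

_≋_ : List ℕ → List ℕ → Set
a ≋ b = (a ⊆ b) × (b ⊆ a)

_⊂_ : List ℕ → List ℕ → Set
a ⊂ b = (a ⊆ b) × ¬ (b ⊆ a)

≋-refl : ∀ {a} → a ≋ a
≋-refl = (λ x → x) , (λ x → x)

≋-sym : ∀ {a b} → a ≋ b → b ≋ a
≋-sym (p , q) = q , p

≋-trans : ∀ {a b c} → a ≋ b → b ≋ c → a ≋ c
≋-trans (p , q) (r , s) = ⊆ₚ.⊆-trans p r , ⊆ₚ.⊆-trans s q

∈ᵇ⇒∈ : ∀ {x} xs → T (x ∈ᵇ xs) → x ∈ xs
∈ᵇ⇒∈ {x} xs t = Any.map (ℕₚ.≡ᵇ⇒≡ x _) (Anyₚ.any⁻ (x ≡ᵇ_) xs t)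

∈⇒∈ᵇ : ∀ {x xs} → x ∈ xs → T (x ∈ᵇ xs)
∈⇒∈ᵇ {x} x∈xs = Anyₚ.any⁺ (x ≡ᵇ_) (Any.map (ℕₚ.≡⇒≡ᵇ x _) x∈xs)

⊆ᵇ⇒⊆ : ∀ xs ys → T (xs ⊆ᵇ ys) → xs ⊆ ys
⊆ᵇ⇒⊆ xs ys t x∈xs = ∈ᵇ⇒∈ ys (All.lookup (Allₚ.all⁺ (_∈ᵇ ys) xs t) x∈xs)

⊆⇒⊆ᵇ : ∀ {xs ys} → xs ⊆ ys → T (xs ⊆ᵇ ys)
⊆⇒⊆ᵇ {xs} {ys} s = Allₚ.all⁻ (_∈ᵇ ys) (All.tabulate (∈⇒∈ᵇ ∘ s))

≐ᵇ⇒≋ : ∀ xs ys → T (xs ≐ᵇ ys) → xs ≋ ys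
≐ᵇ⇒≋ xs ys t = ⊆ᵇ⇒⊆ xs ys (T-∧⁻ˡ t) , ⊆ᵇ⇒⊆ ys xs (T-∧⁻ʳ {xs ⊆ᵇ ys} t)

≋⇒≐ᵇ : ∀ {xs ys} → xs ≋ ys → T (xs ≐ᵇ ys)
≋⇒≐ᵇ (p , q) = T-∧⁺ (⊆⇒⊆ᵇ p) (⊆⇒⊆ᵇ q)

⊂ᵇ⇒⊂ : ∀ xs ys → T (xs ⊂ᵇ ys) → xs ⊂ ys
⊂ᵇ⇒⊂ xs ys t = ⊆ᵇ⇒⊆ xs ys (T-∧⁻ˡ t) , T-not⁻ (T-∧⁻ʳ {xs ⊆ᵇ ys} t) ∘ ⊆⇒⊆ᵇ

⊂⇒⊂ᵇ : ∀ {xs ys} → xs ⊂ ys → T (xs ⊂ᵇ ys)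
⊂⇒⊂ᵇ (p , q) = T-∧⁺ (⊆⇒⊆ᵇ p) (T-not⁺ (q ∘ ⊆ᵇ⇒⊆ _ _))

∈-∖⁻ : ∀ {x} xs ys → x ∈ xs ∖ ys → x ∈ xs × x ∉ ys
∈-∖⁻ xs ys x∈ with ∈-filterᵇ⁻ (λ x → not (x ∈ᵇ ys)) x∈
... | x∈xs , x∉ = x∈xs , T-not⁻ x∉ ∘ ∈⇒∈ᵇ

∈-∖⁺ : ∀ {x} xs ys → x ∈ xs → x ∉ ys → x ∈ xs ∖ ys
∈-∖⁺ xs ys x∈xs x∉ys = ∈-filterᵇ⁺ (λ x → not (x ∈ᵇ ys)) x∈xs (T-not⁺ (x∉ys ∘ ∈ᵇ⇒∈ ys))

∖-⊆ : ∀ a b → a ∖ b ⊆ a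
∖-⊆ a b = proj₁ ∘ ∈-∖⁻ a b

∖-resp-≋ : ∀ {a a′ b b′} → a ≋ a′ → b ≋ b′ → a ∖ b ≋ a′ ∖ b′
∖-resp-≋ {a} {a′} {b} {b′} (p , q) (r , s) = sub a a′ b b′ p s , sub a′ a b′ b q r
  where
  sub : ∀ a a′ b b′ → a ⊆ a′ → b′ ⊆ b → a ∖ b ⊆ a′ ∖ b′
  sub a a′ b b′ a⊆ b′⊆ x∈ = let x∈a , x∉b = ∈-∖⁻ a b x∈ in ∈-∖⁺ a′ b′ (a⊆ x∈a) (x∉b ∘ b′⊆)

meets⁻ : ∀ xs ys → T (meets xs ys) → ∃ λ x → x ∈ xs × x ∈ ys
meets⁻ xs ys t with find (Anyₚ.any⁻ (_∈ᵇ ys) xs t)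
... | x , x∈xs , x∈ᵇys = x , x∈xs , ∈ᵇ⇒∈ ys x∈ᵇys

meets⁺ : ∀ {x xs ys} → x ∈ xs → x ∈ ys → T (meets xs ys)
meets⁺ {ys = ys} x∈xs x∈ys = Anyₚ.any⁺ (_∈ᵇ ys) (lose x∈xs (∈⇒∈ᵇ x∈ys))

++-resp-≋ : ∀ {a a′ b b′ : List ℕ} → a ≋ a′ → b ≋ b′ → a ++ b ≋ a′ ++ b′
++-resp-≋ (p , q) (r , s) = ⊆ₚ.++⁺ p r , ⊆ₚ.++⁺ q s

++-comm-≋ : ∀ (a b : List ℕ) → a ++ b ≋ b ++ a
++-comm-≋ a b = ++-comm-⊆ a b , ++-comm-⊆ b a
  where
  ++-comm-⊆ : ∀ a b → a ++ b ⊆ b ++ a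
  ++-comm-⊆ a b x∈ = [ ∈ₚ.∈-++⁺ʳ b , ∈ₚ.∈-++⁺ˡ ]′ (∈ₚ.∈-++⁻ a x∈)

length-⊆ : ∀ {a b : List ℕ} → Unique a → a ⊆ b → length a ≤ length b
length-⊆ {[]} _ _ = z≤n
length-⊆ {x ∷ a} {b} (x∉a ∷ ua) s with ∈ₚ.∈-∃++ (s (here refl))
... | p , q , refl =
  ℕₚ.≤-trans (s≤s (length-⊆ ua a⊆p++q))
    (ℕₚ.≤-reflexive (trans (cong suc (Listₚ.length-++ p))
      (trans (sym (ℕₚ.+-suc (length p) (length q))) (sym (Listₚ.length-++ p)))))
  where
  a⊆p++q : a ⊆ p ++ q
  a⊆p++q {y} y∈a with ∈ₚ.∈-++⁻ p (s (there y∈a))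
  ... | inj₁ y∈p = ∈ₚ.∈-++⁺ˡ y∈p
  ... | inj₂ (here y≡x) = ⊥-elim (All.lookup x∉a y∈a (sym y≡x))
  ... | inj₂ (there y∈q) = ∈ₚ.∈-++⁺ʳ p y∈q

length-≋ : ∀ {a b : List ℕ} → Unique a → Unique b → a ≋ b → length a ≡ length b
length-≋ ua ub (s , t) = ℕₚ.≤-antisym (length-⊆ ua s) (length-⊆ ub t)

Unique-∖ : ∀ {a} b → Unique a → Unique (a ∖ b)
Unique-∖ b = Uniqueₚ.filter⁺ (λ x → T? (not (x ∈ᵇ b)))

infix 4 _≤∞_
data _≤∞_ : ℕ∞ → ℕ∞ → Set where
  fin≤fin : ∀ {m n} → m ≤ n → fin m ≤∞ fin n
  _≤∞∞    : ∀ x → x ≤∞ ∞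

≤∞-trans : ∀ {x y z} → x ≤∞ y → y ≤∞ z → x ≤∞ z
≤∞-trans (fin≤fin p) (fin≤fin q) = fin≤fin (ℕₚ.≤-trans p q)
≤∞-trans _ (_ ≤∞∞) = _ ≤∞∞

≤∞-antisym : ∀ {x y} → x ≤∞ y → y ≤∞ x → x ≡ y
≤∞-antisym (fin≤fin p) (fin≤fin q) = cong fin (ℕₚ.≤-antisym p q)
≤∞-antisym (∞ ≤∞∞) (∞ ≤∞∞) = refl

fin0≤∞ : ∀ {x} → fin 0 ≤∞ x
fin0≤∞ {fin x} = fin≤fin z≤n
fin0≤∞ {∞} = _ ≤∞∞

max∞-upperˡ : ∀ x y → x ≤∞ max∞ x y
max∞-upperˡ (fin m) (fin n) = fin≤fin (ℕₚ.m≤m⊔n m n)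
max∞-upperˡ (fin m) ∞ = _ ≤∞∞
max∞-upperˡ ∞ y = _ ≤∞∞

max∞-upperʳ : ∀ x y → y ≤∞ max∞ x y
max∞-upperʳ (fin m) (fin n) = fin≤fin (ℕₚ.m≤n⊔m m n)
max∞-upperʳ (fin m) ∞ = _ ≤∞∞
max∞-upperʳ ∞ y = _ ≤∞∞

max∞-lub : ∀ {x y z} → x ≤∞ z → y ≤∞ z → max∞ x y ≤∞ z
max∞-lub {z = ∞} _ _ = _ ≤∞∞
max∞-lub (fin≤fin p) (fin≤fin q) = fin≤fin (ℕₚ.⊔-lub p q)

max∞-sel : ∀ x y → max∞ x y ≡ x ⊎ max∞ x y ≡ y
max∞-sel (fin m) (fin n) with ℕₚ.≤-total m n
... | inj₁ m≤n = inj₂ (cong fin (ℕₚ.m≤n⇒m⊔n≡n m≤n))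
... | inj₂ n≤m = inj₁ (cong fin (ℕₚ.m≥n⇒m⊔n≡m n≤m))
max∞-sel (fin m) ∞ = inj₂ refl
max∞-sel ∞ y = inj₁ refl

max∞-identityʳ : ∀ x → max∞ x (fin 0) ≡ x
max∞-identityʳ (fin m) = cong fin (ℕₚ.⊔-identityʳ m)
max∞-identityʳ ∞ = refl

module _ {A : Set} (f : A → ℕ∞) where

  maxList-upper : ∀ {x xs} → x ∈ xs → f x ≤∞ maxList (map f xs)
  maxList-upper {xs = y ∷ xs} (here refl) = max∞-upperˡ (f y) _
  maxList-upper {xs = y ∷ xs} (there x∈) = ≤∞-trans (maxList-upper x∈) (max∞-upperʳ (f y) _)

  maxList-lub : ∀ {b} xs → (∀ {x} → x ∈ xs → f x ≤∞ b) → maxList (map f xs) ≤∞ b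
  maxList-lub [] _ = fin0≤∞
  maxList-lub (y ∷ xs) bound = max∞-lub (bound (here refl)) (maxList-lub xs (bound ∘ there))

  maxList-attained : ∀ y xs → ∃ λ x → x ∈ y ∷ xs × maxList (map f (y ∷ xs)) ≡ f x
  maxList-attained y [] = y , here refl , max∞-identityʳ (f y)
  maxList-attained y (z ∷ xs) with maxList-attained z xs
  ... | x , x∈ , eq with max∞-sel (f y) (maxList (map f (z ∷ xs)))
  ... | inj₁ eq′ = y , here refl , eq′
  ... | inj₂ eq′ = x , there x∈ , trans eq′ eq

maxList-cong : ∀ {A B : Set} (f : A → ℕ∞) (g : B → ℕ∞) xs ys →
  (∀ {x} → x ∈ xs → ∃ λ y → y ∈ ys × f x ≡ g y) →
  (∀ {y} → y ∈ ys → ∃ λ x → x ∈ xs × f x ≡ g y) →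
  maxList (map f xs) ≡ maxList (map g ys)
maxList-cong f g xs ys to from = ≤∞-antisym
  (maxList-lub f xs λ x∈ → let _ , y∈ , eq = to x∈ in subst (_≤∞ _) (sym eq) (maxList-upper g y∈))
  (maxList-lub g ys λ y∈ → let _ , x∈ , eq = from y∈ in subst (_≤∞ _) eq (maxList-upper f x∈))

+∞-comm : ∀ x y → x +∞ y ≡ y +∞ x
+∞-comm (fin m) (fin n) = cong fin (ℕₚ.+-comm m n)
+∞-comm (fin m) ∞ = refl
+∞-comm ∞ (fin n) = refl
+∞-comm ∞ ∞ = refl

+∞-assoc : ∀ x y z → (x +∞ y) +∞ z ≡ x +∞ (y +∞ z)
+∞-assoc (fin m) (fin n) (fin k) = cong fin (ℕₚ.+-assoc m n k)
+∞-assoc (fin m) (fin n) ∞ = refl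
+∞-assoc (fin m) ∞ z = refl
+∞-assoc ∞ y z = refl

+∞-identityˡ : ∀ x → fin 0 +∞ x ≡ x
+∞-identityˡ (fin m) = refl
+∞-identityˡ ∞ = refl

+∞-identityʳ : ∀ x → x +∞ fin 0 ≡ x
+∞-identityʳ (fin m) = cong fin (ℕₚ.+-identityʳ m)
+∞-identityʳ ∞ = refl

+∞-monoˡ-≤∞ : ∀ {x y} z → x ≤∞ y → x +∞ z ≤∞ y +∞ z
+∞-monoˡ-≤∞ (fin k) (fin≤fin p) = fin≤fin (ℕₚ.+-monoˡ-≤ k p)
+∞-monoˡ-≤∞ ∞ (fin≤fin p) = _ ≤∞∞
+∞-monoˡ-≤∞ z (_ ≤∞∞) = _ ≤∞∞

+∞-monoʳ-≤∞ : ∀ {x y} z → x ≤∞ y → z +∞ x ≤∞ z +∞ y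
+∞-monoʳ-≤∞ {x} {y} z p = subst₂ _≤∞_ (+∞-comm x z) (+∞-comm y z) (+∞-monoˡ-≤∞ z p)

min∞-+∞-distribʳ : ∀ a b c → min∞ (a +∞ c) (b +∞ c) ≡ min∞ a b +∞ c
min∞-+∞-distribʳ (fin m) (fin n) (fin k) = cong fin (sym (ℕₚ.+-distribʳ-⊓ k m n))
min∞-+∞-distribʳ (fin m) (fin n) ∞ = refl
min∞-+∞-distribʳ (fin m) ∞ (fin k) = refl
min∞-+∞-distribʳ (fin m) ∞ ∞ = refl
min∞-+∞-distribʳ ∞ b (fin k) = refl
min∞-+∞-distribʳ ∞ (fin n) ∞ = refl
min∞-+∞-distribʳ ∞ ∞ ∞ = refl

-- The shape of one recursion step of ψ on a disjoint union.
min∞-step-+∞ʳ : ∀ a b c x → min∞ (a +∞ x) ((b +∞ x) +∞ c) ≡ min∞ a (b +∞ c) +∞ x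
min∞-step-+∞ʳ a b c x = trans
  (cong (min∞ (a +∞ x)) (trans (+∞-assoc b x c)
    (trans (cong (b +∞_) (+∞-comm x c)) (sym (+∞-assoc b c x)))))
  (min∞-+∞-distribʳ a (b +∞ c) x)

min∞-step-+∞ˡ : ∀ a b c x → min∞ (x +∞ a) ((x +∞ b) +∞ c) ≡ x +∞ min∞ a (b +∞ c)
min∞-step-+∞ˡ a b c x = trans
  (cong₂ min∞ (+∞-comm x a) (trans (+∞-assoc x b c) (+∞-comm x (b +∞ c))))
  (trans (min∞-+∞-distribʳ a (b +∞ c) x) (+∞-comm _ x))

module _ {A : Set} where

  private
    picks-∷⁻ : ∀ {x : A} {xs F r} → (F , r) ∈ map (λ { (y , ys) → (y , x ∷ ys) }) (picks xs) →
               ∃ λ ys → (F , ys) ∈ picks xs × r ≡ x ∷ ys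
    picks-∷⁻ p∈ with ∈ₚ.∈-map⁻ _ p∈
    ... | (y , ys) , p∈′ , refl = ys , p∈′ , refl

  picks-∷⁺ : ∀ {x : A} {xs F ys} → (F , ys) ∈ picks xs → (F , x ∷ ys) ∈ picks (x ∷ xs)
  picks-∷⁺ {x} p∈ = there (∈ₚ.∈-map⁺ (λ { (y , ys) → (y , x ∷ ys) }) p∈)

  picks-elem-∈ : ∀ {F r} (E : List A) → (F , r) ∈ picks E → F ∈ E
  picks-elem-∈ (x ∷ xs) (here refl) = here refl
  picks-elem-∈ (x ∷ xs) (there p∈) with picks-∷⁻ p∈
  ... | ys , p∈′ , refl = there (picks-elem-∈ xs p∈′)

  picks-rest-⊆ : ∀ {F r} (E : List A) → (F , r) ∈ picks E → ∀ {z} → z ∈ r → z ∈ E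
  picks-rest-⊆ (x ∷ xs) (here refl) z∈ = there z∈
  picks-rest-⊆ (x ∷ xs) (there p∈) z∈ with picks-∷⁻ p∈
  ... | ys , p∈′ , refl with z∈
  ... | here z≡x = here z≡x
  ... | there z∈ys = there (picks-rest-⊆ xs p∈′ z∈ys)

  picks-split : ∀ {F r} (E : List A) → (F , r) ∈ picks E → ∀ {z} → z ∈ E → z ≡ F ⊎ z ∈ r
  picks-split (x ∷ xs) (here refl) (here z≡x) = inj₁ z≡x
  picks-split (x ∷ xs) (here refl) (there z∈) = inj₂ z∈
  picks-split (x ∷ xs) (there p∈) z∈ with picks-∷⁻ p∈
  ... | ys , p∈′ , refl with z∈
  ... | here z≡x = inj₂ (here z≡x)
  ... | there z∈xs with picks-split xs p∈′ z∈xs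
  ...   | inj₁ z≡F = inj₁ z≡F
  ...   | inj₂ z∈ys = inj₂ (there z∈ys)

  picks-length : ∀ {F r} (E : List A) → (F , r) ∈ picks E → suc (length r) ≡ length E
  picks-length (x ∷ xs) (here refl) = refl
  picks-length (x ∷ xs) (there p∈) with picks-∷⁻ p∈
  ... | ys , p∈′ , refl = cong suc (picks-length xs p∈′)

  picks-length-≤ : ∀ {k F r} (E : List A) → (F , r) ∈ picks E → length E ≤ suc k → length r ≤ k
  picks-length-≤ {k} E p∈ ≤k = ℕₚ.≤-pred (subst (_≤ suc k) (sym (picks-length E p∈)) ≤k)

  picks-complete : ∀ {F} {E : List A} → F ∈ E → ∃ λ r → (F , r) ∈ picks E
  picks-complete {E = x ∷ xs} (here refl) = xs , here refl
  picks-complete {E = x ∷ xs} (there F∈) with picks-complete F∈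
  ... | ys , p∈ = x ∷ ys , picks-∷⁺ p∈

  picks-All : ∀ {P : A → Set} {F r} {E : List A} → All P E → (F , r) ∈ picks E → P F × All P r
  picks-All {E = E} all p∈ =
    All.lookup all (picks-elem-∈ E p∈) , All.tabulate (All.lookup all ∘ picks-rest-⊆ E p∈)

  picks-AllPairs : ∀ {R : A → A → Set} → (∀ {a b} → R a b → R b a) → ∀ {F r} {E : List A} →
                   AllPairs R E → (F , r) ∈ picks E → All (R F) r × AllPairs R r
  picks-AllPairs R-sym {E = x ∷ xs} (Rx ∷ Rxs) (here refl) = Rx , Rxs
  picks-AllPairs R-sym {E = x ∷ xs} (Rx ∷ Rxs) (there p∈) with picks-∷⁻ p∈
  ... | ys , p∈′ , refl with picks-AllPairs R-sym Rxs p∈′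
  ... | RF , Rys = R-sym (All.lookup Rx (picks-elem-∈ xs p∈′)) ∷ RF ,
                   All.tabulate (All.lookup Rx ∘ picks-rest-⊆ xs p∈′) ∷ Rys

  picks-++⁻ : ∀ {F r} (X Y : List A) → (F , r) ∈ picks (X ++ Y) →
    (∃ λ r₁ → (F , r₁) ∈ picks X × r ≡ r₁ ++ Y) ⊎ (∃ λ r₂ → (F , r₂) ∈ picks Y × r ≡ X ++ r₂)
  picks-++⁻ [] Y p∈ = inj₂ (_ , p∈ , refl)
  picks-++⁻ (x ∷ X) Y (here refl) = inj₁ (X , here refl , refl)
  picks-++⁻ (x ∷ X) Y (there p∈) with picks-∷⁻ p∈
  ... | ys , p∈′ , refl with picks-++⁻ X Y p∈′
  ... | inj₁ (r₁ , p∈₁ , eq) = inj₁ (x ∷ r₁ , picks-∷⁺ p∈₁ , cong (x ∷_) eq)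
  ... | inj₂ (r₂ , p∈₂ , eq) = inj₂ (r₂ , p∈₂ , cong (x ∷_) eq)

  picks-++⁺ˡ : ∀ {F r} (X Y : List A) → (F , r) ∈ picks X → (F , r ++ Y) ∈ picks (X ++ Y)
  picks-++⁺ˡ (x ∷ X) Y (here refl) = here refl
  picks-++⁺ˡ (x ∷ X) Y (there p∈) with picks-∷⁻ p∈
  ... | ys , p∈′ , refl = picks-∷⁺ (picks-++⁺ˡ X Y p∈′)

  picks-++⁺ʳ : ∀ {F r} (X Y : List A) → (F , r) ∈ picks Y → (F , X ++ r) ∈ picks (X ++ Y)
  picks-++⁺ʳ [] Y p∈ = p∈
  picks-++⁺ʳ (x ∷ X) Y p∈ = picks-∷⁺ (picks-++⁺ʳ X Y p∈)

Matched : List (List ℕ) → List (List ℕ) → Set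
Matched E E′ = ∀ {S} → S ∈ E → ∃ λ S′ → S′ ∈ E′ × S ≋ S′

IsUnion : List (List ℕ) → List (List ℕ) → List (List ℕ) → Set
IsUnion E A B = (∀ {S} → S ∈ E → S ∈ A ⊎ S ∈ B) × (∀ {S} → S ∈ A ⊎ S ∈ B → S ∈ E)

++-IsUnion : ∀ A B → IsUnion (A ++ B) A B
++-IsUnion A B = ∈ₚ.∈-++⁻ A , [ ∈ₚ.∈-++⁺ˡ , ∈ₚ.∈-++⁺ʳ A ]′

++-IsUnion-swap : ∀ A B → IsUnion (B ++ A) A B
++-IsUnion-swap A B = swap ∘ ∈ₚ.∈-++⁻ B , [ ∈ₚ.∈-++⁺ʳ B , ∈ₚ.∈-++⁺ˡ ]′

Distinct : List (List ℕ) → Set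
Distinct = AllPairs (λ a b → ¬ (a ≋ b))

Incomparable : List ℕ → List ℕ → Set
Incomparable a b = ¬ (a ⊆ b) × ¬ (b ⊆ a)

Incomparable-sym : ∀ {a b} → Incomparable a b → Incomparable b a
Incomparable-sym (p , q) = q , p

AllPairs-∈ : ∀ {R : List ℕ → List ℕ → Set} {xs x y} → (∀ {a b} → R a b → R b a) →
             AllPairs R xs → x ∈ xs → y ∈ xs → x ≡ y ⊎ R x y
AllPairs-∈ R-sym (Rx ∷ Rxs) (here refl) (here refl) = inj₁ refl
AllPairs-∈ R-sym (Rx ∷ Rxs) (here refl) (there y∈) = inj₂ (All.lookup Rx y∈)
AllPairs-∈ R-sym (Rx ∷ Rxs) (there x∈) (here refl) = inj₂ (R-sym (All.lookup Rx x∈))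
AllPairs-∈ R-sym (Rx ∷ Rxs) (there x∈) (there y∈) = AllPairs-∈ R-sym Rxs x∈ y∈

MinimalIn : List (List ℕ) → List ℕ → Set
MinimalIn L S = S ∈ L × (∀ {U} → U ∈ L → ¬ (U ⊂ S))

module _ (L : List (List ℕ)) where

  private
    unbeaten : List ℕ → Bool
    unbeaten S = not (any (_⊂ᵇ S) L)

    ≐? : ∀ x y → Dec (T (x ≐ᵇ y))
    ≐? x y = T? (x ≐ᵇ y)

    deduplicate-Distinct : ∀ xs → Distinct (deduplicate ≐? xs)
    deduplicate-Distinct [] = []
    deduplicate-Distinct (x ∷ xs) =
      All.map (λ x≉y x≋y → x≉y (≋⇒≐ᵇ x≋y)) (Allₚ.all-filter (¬? ∘ ≐? x) (deduplicate ≐? xs)) ∷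
      AllPairsₚ.filter⁺ (¬? ∘ ≐? x) (deduplicate-Distinct xs)

  ∈-minimalSets⁻ : ∀ {S} → S ∈ minimalSets L → MinimalIn L S
  ∈-minimalSets⁻ {S} S∈ with ∈-filterᵇ⁻ unbeaten (∈ₚ.∈-deduplicate⁻ ≐? (filterᵇ unbeaten L) S∈)
  ... | S∈L , t = S∈L , λ U∈ U⊂S → T-not⁻ t (Anyₚ.any⁺ (_⊂ᵇ S) (lose U∈ (⊂⇒⊂ᵇ U⊂S)))

  ∈-minimalSets⁺ : ∀ {S} → MinimalIn L S → ∃ λ S′ → S′ ∈ minimalSets L × S′ ≋ S
  ∈-minimalSets⁺ {S} (S∈L , minimal) =
    find (Anyₚ.deduplicate⁺ ≐? {P = _≋ S} (λ b≐a a≋S → ≋-trans (≐ᵇ⇒≋ _ _ b≐a) a≋S)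
                            (lose (∈-filterᵇ⁺ unbeaten S∈L S-unbeaten) ≋-refl))
    where
    S-unbeaten : T (unbeaten S)
    S-unbeaten = T-not⁺ λ t → let U , U∈ , U⊂ᵇS = find (Anyₚ.any⁻ (_⊂ᵇ S) L t) in
                                minimal U∈ (⊂ᵇ⇒⊂ U S U⊂ᵇS)

  minimalSets-Distinct : Distinct (minimalSets L)
  minimalSets-Distinct = deduplicate-Distinct (filterᵇ unbeaten L)

  minimalSets-Incomparable : AllPairs Incomparable (minimalSets L)
  minimalSets-Incomparable =
    incomparable (minimalSets L) minimalSets-Distinct (All.tabulate ∈-minimalSets⁻)
    where
    incomparable : ∀ xs → Distinct xs → All (MinimalIn L) xs → AllPairs Incomparable xs
    incomparable [] _ _ = []
    incomparable (x ∷ xs) (x≉ ∷ ≉) ((x∈L , x-min) ∷ min) =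
      All.zipWith pair (x≉ , min) ∷ incomparable xs ≉ min
      where
      pair : ∀ {y} → ¬ (x ≋ y) × MinimalIn L y → Incomparable x y
      pair (x≉y , y∈L , y-min) = (λ x⊆y → y-min x∈L (x⊆y , λ y⊆x → x≉y (x⊆y , y⊆x))) ,
                                 (λ y⊆x → x-min y∈L (y⊆x , λ x⊆y → x≉y (x⊆y , y⊆x)))

  length-minimalSets : length (minimalSets L) ≤ length L
  length-minimalSets = ℕₚ.≤-trans (Listₚ.length-deduplicate ≐? (filterᵇ unbeaten L))
                                  (Listₚ.length-filter (T? ∘ unbeaten) L)

minimalSets-Matched : ∀ {L L′} → Matched L L′ → Matched L′ L → Matched (minimalSets L) (minimalSets L′)
minimalSets-Matched {L} {L′} to from S∈ with ∈-minimalSets⁻ L S∈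
... | S∈L , S-min with to S∈L
... | S′ , S′∈ , S≋S′ with ∈-minimalSets⁺ L′ (S′∈ , S′-min)
  where
  S′-min : ∀ {U} → U ∈ L′ → ¬ (U ⊂ S′)
  S′-min U∈ (U⊆ , ⊉U) with from U∈
  ... | U₀ , U₀∈ , U≋U₀ = S-min U₀∈
    ( ⊆ₚ.⊆-trans (proj₂ U≋U₀) (⊆ₚ.⊆-trans U⊆ (proj₂ S≋S′))
    , λ S⊆U₀ → ⊉U (⊆ₚ.⊆-trans (proj₂ S≋S′) (⊆ₚ.⊆-trans S⊆U₀ (proj₂ U≋U₀))) )
... | S″ , S″∈ , S″≋S′ = S″ , S″∈ , ≋-trans S≋S′ (≋-sym S″≋S′)

-- Deletion and contraction of an edge

∈-nbhd⁻ : ∀ {x} F rest → x ∈ nbhd F rest → ∃ λ S → S ∈ rest × length (S ∖ F) ≡ 1 × x ∈ S ∖ F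
∈-nbhd⁻ F rest x∈ with find (∈ₚ.∈-concat⁻ (filterᵇ (λ S → length S ≡ᵇ 1) (map (_∖ F) rest)) x∈)
... | _ , Z∈ , x∈Z with ∈-filterᵇ⁻ (λ S → length S ≡ᵇ 1) Z∈
... | Z∈map , |Z|≡1 with ∈ₚ.∈-map⁻ (_∖ F) Z∈map
... | S , S∈ , refl = S , S∈ , ℕₚ.≡ᵇ⇒≡ _ 1 |Z|≡1 , x∈Z

∈-nbhd⁺ : ∀ {x S} F rest → S ∈ rest → length (S ∖ F) ≡ 1 → x ∈ S ∖ F → x ∈ nbhd F rest
∈-nbhd⁺ F rest S∈ |S∖F|≡1 x∈ = ∈ₚ.∈-concat⁺′ x∈
  (∈-filterᵇ⁺ (λ S → length S ≡ᵇ 1) (∈ₚ.∈-map⁺ (_∖ F) S∈) (ℕₚ.≡⇒≡ᵇ _ 1 |S∖F|≡1))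

nbhd-Matched : ∀ {F F′ rest rest′} → All Unique rest → All Unique rest′ → Matched rest rest′ →
               F ≋ F′ → nbhd F rest ⊆ nbhd F′ rest′
nbhd-Matched {F} {F′} {rest} {rest′} u u′ match F≋F′ x∈ with ∈-nbhd⁻ F rest x∈
... | S , S∈ , |S∖F|≡1 , x∈S∖F with match S∈
... | S′ , S′∈ , S≋S′ = ∈-nbhd⁺ F′ rest′ S′∈ (trans (sym |S∖F|≡|S′∖F′|) |S∖F|≡1) (proj₁ eq x∈S∖F)
  where
  eq = ∖-resp-≋ S≋S′ F≋F′
  |S∖F|≡|S′∖F′| = length-≋ (Unique-∖ F (All.lookup u S∈)) (Unique-∖ F′ (All.lookup u′ S′∈)) eq

colonCandidate : List ℕ → List (List ℕ) → List ℕ → Bool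
colonCandidate F rest S = (1 <ᵇ length S) ∧ not (meets S (nbhd F rest))

colonCandidates : List ℕ → List (List ℕ) → List (List ℕ)
colonCandidates F rest = filterᵇ (colonCandidate F rest) (map (_∖ F) rest)

colonCandidate-length : ∀ {F rest S} → T (colonCandidate F rest S) → 2 ≤ length S
colonCandidate-length {S = S} t = ℕₚ.<ᵇ⇒< 1 (length S) (T-∧⁻ˡ t)

colonCandidate-avoids : ∀ {F rest S x} → T (colonCandidate F rest S) → x ∈ S → x ∉ nbhd F rest
colonCandidate-avoids {S = S} t x∈S x∈N = T-not⁻ (T-∧⁻ʳ {1 <ᵇ length S} t) (meets⁺ x∈S x∈N)

colonCandidate-antitone : ∀ {F A B S} → nbhd F A ⊆ nbhd F B →
                          T (colonCandidate F B S) → T (colonCandidate F A S)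
colonCandidate-antitone {F} {A} {B} {S} NA⊆NB t = T-∧⁺ (T-∧⁻ˡ t) (T-not⁺ λ m →
  let _ , x∈S , x∈NA = meets⁻ S (nbhd F A) m in colonCandidate-avoids {F} {B} {S} t x∈S (NA⊆NB x∈NA))

∈-colonCandidates⁻ : ∀ {S} F rest → S ∈ colonCandidates F rest →
                     ∃ λ R → R ∈ rest × S ≡ R ∖ F × T (colonCandidate F rest S)
∈-colonCandidates⁻ F rest S∈ with ∈-filterᵇ⁻ (colonCandidate F rest) S∈
... | S∈map , t with ∈ₚ.∈-map⁻ (_∖ F) S∈map
... | R , R∈ , refl = R , R∈ , refl , t

∈-colonCandidates⁺ : ∀ {R} F rest → R ∈ rest → T (colonCandidate F rest (R ∖ F)) →
                     R ∖ F ∈ colonCandidates F rest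
∈-colonCandidates⁺ F rest R∈ = ∈-filterᵇ⁺ (colonCandidate F rest) (∈ₚ.∈-map⁺ (_∖ F) R∈)

colonCandidates-Unique : ∀ F rest → All Unique rest → All Unique (colonCandidates F rest)
colonCandidates-Unique F rest u = All.tabulate λ S∈ →
  let R , R∈ , S≡R∖F , _ = ∈-colonCandidates⁻ F rest S∈ in
  subst Unique (sym S≡R∖F) (Unique-∖ F (All.lookup u R∈))

colonCandidates-Matched : ∀ {F F′ rest rest′} → All Unique rest → All Unique rest′ →
  Matched rest rest′ → F ≋ F′ → nbhd F′ rest′ ⊆ nbhd F rest →
  Matched (colonCandidates F rest) (colonCandidates F′ rest′)
colonCandidates-Matched {F} {F′} {rest} {rest′} u u′ match F≋F′ N′⊆N S∈
  with ∈-colonCandidates⁻ F rest S∈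
... | R , R∈ , refl , t with match R∈
... | R′ , R′∈ , R≋R′ = R′ ∖ F′ , ∈-colonCandidates⁺ F′ rest′ R′∈ t′ , eq
  where
  eq = ∖-resp-≋ R≋R′ F≋F′
  same-length : length (R ∖ F) ≡ length (R′ ∖ F′)
  same-length = length-≋ (Unique-∖ F (All.lookup u R∈)) (Unique-∖ F′ (All.lookup u′ R′∈)) eq
  t′ : T (colonCandidate F′ rest′ (R′ ∖ F′))
  t′ = T-∧⁺ (subst (λ k → T (1 <ᵇ k)) same-length (T-∧⁻ˡ t)) (T-not⁺ λ m →
         let _ , x∈ , x∈N′ = meets⁻ (R′ ∖ F′) _ m in
         colonCandidate-avoids {F} {rest} {R ∖ F} t (proj₂ eq x∈) (N′⊆N x∈N′))

∈-colonE⁻ : ∀ {S} F rest → S ∈ colonE F rest →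
            ∃ λ R → R ∈ rest × S ≡ R ∖ F × T (colonCandidate F rest S)
∈-colonE⁻ F rest = ∈-colonCandidates⁻ F rest ∘ proj₁ ∘ ∈-minimalSets⁻ (colonCandidates F rest)

colonE-Unique : ∀ F rest → All Unique rest → All Unique (colonE F rest)
colonE-Unique F rest u = All.tabulate
  (All.lookup (colonCandidates-Unique F rest u) ∘ proj₁ ∘ ∈-minimalSets⁻ (colonCandidates F rest))

length-colonE : ∀ F rest → length (colonE F rest) ≤ length rest
length-colonE F rest = ℕₚ.≤-trans (length-minimalSets (colonCandidates F rest))
  (ℕₚ.≤-trans (Listₚ.length-filter (T? ∘ colonCandidate F rest) (map (_∖ F) rest))
              (ℕₚ.≤-reflexive (Listₚ.length-map (_∖ F) rest)))

∈-colonV⁻ : ∀ {x} V F rest → x ∈ colonV V F rest → x ∈ V × x ∉ F × x ∉ nbhd F rest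
∈-colonV⁻ V F rest x∈ with ∈-∖⁻ V (F ++ nbhd F rest) x∈
... | x∈V , x∉ = x∈V , x∉ ∘ ∈ₚ.∈-++⁺ˡ , x∉ ∘ ∈ₚ.∈-++⁺ʳ F

∈-colonV⁺ : ∀ {x} V F rest → x ∈ V → x ∉ F → x ∉ nbhd F rest → x ∈ colonV V F rest
∈-colonV⁺ V F rest x∈V x∉F x∉N =
  ∈-∖⁺ V (F ++ nbhd F rest) x∈V ([ x∉F , x∉N ]′ ∘ ∈ₚ.∈-++⁻ F)

record IsHypergraph (V : List ℕ) (E : List (List ℕ)) : Set where
  field
    edges-unique       : All Unique E
    edges-incomparable : AllPairs Incomparable E
    edges-⊆            : All (_⊆ V) E
    edges-size         : All (λ e → 2 ≤ length e) E
open IsHypergraph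

2≤length⇒nonempty : ∀ {e : List ℕ} → 2 ≤ length e → ∃ λ x → x ∈ e
2≤length⇒nonempty {x ∷ e} _ = x , here refl

edges-Distinct : ∀ {V E} → IsHypergraph V E → Distinct E
edges-Distinct h =
  AllPairs.map (λ incomp e≋e′ → proj₁ incomp (λ {x} → proj₁ e≋e′ {x})) (edges-incomparable h)

AllPairs-lookup : ∀ (xs : List (List ℕ)) →
  (∀ (i j : Fin (length xs)) → i ≢ j → ¬ (lookup xs i ⊆ lookup xs j)) → AllPairs Incomparable xs
AllPairs-lookup [] _ = []
AllPairs-lookup (x ∷ xs) incomp =
  All.tabulate (λ y∈ → let i = Any.index y∈ ; y≡ = Anyₚ.lookup-index y∈ in
    (λ x⊆y → incomp zero (suc i) (λ ()) (subst (_ ∈_) y≡ ∘ x⊆y)) ,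
    (λ y⊆x → incomp (suc i) zero (λ ()) (y⊆x ∘ subst (_ ∈_) (sym y≡)))) ∷
  AllPairs-lookup xs (λ i j i≢j → incomp (suc i) (suc j) (i≢j ∘ Finₚ.suc-injective))

WF⇒IsHypergraph : ∀ C → WF C → IsHypergraph (vertices C) (edges C)
WF⇒IsHypergraph C wf = record
  { edges-unique       = WF.edges-unique wf
  ; edges-incomparable = AllPairs-lookup (edges C) (WF.incomparable wf)
  ; edges-⊆            = WF.edges-⊆ wf
  ; edges-size         = WF.edges-size wf
  }

IsHypergraph-rest : ∀ {V E F r} → IsHypergraph V E → (F , r) ∈ picks E → IsHypergraph V r
IsHypergraph-rest h p∈ = record
  { edges-unique       = proj₂ (picks-All (edges-unique h) p∈)
  ; edges-incomparable = proj₂ (picks-AllPairs Incomparable-sym (edges-incomparable h) p∈)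
  ; edges-⊆            = proj₂ (picks-All (edges-⊆ h) p∈)
  ; edges-size         = proj₂ (picks-All (edges-size h) p∈)
  }

IsHypergraph-colon : ∀ {V E F r} → IsHypergraph V E → (F , r) ∈ picks E →
                     IsHypergraph (colonV V F r) (colonE F r)
IsHypergraph-colon {V} {E} {F} {r} h p∈ = record
  { edges-unique       = colonE-Unique F r (edges-unique hr)
  ; edges-incomparable = minimalSets-Incomparable (colonCandidates F r)
  ; edges-⊆            = All.tabulate ⊆colonV
  ; edges-size         = All.tabulate λ {S} S∈ →
                           colonCandidate-length {F} {r} {S} (proj₂ (proj₂ (proj₂ (∈-colonE⁻ F r S∈))))
  }
  where
  hr = IsHypergraph-rest h p∈
  ⊆colonV : ∀ {S} → S ∈ colonE F r → S ⊆ colonV V F r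
  ⊆colonV S∈ x∈ with ∈-colonE⁻ F r S∈
  ... | R , R∈ , refl , t with ∈-∖⁻ R F x∈
  ... | x∈R , x∉F = ∈-colonV⁺ V F r (All.lookup (edges-⊆ hr) R∈ x∈R) x∉F
                               (colonCandidate-avoids {F} {r} {R ∖ F} t x∈)

IsHypergraph-++ : ∀ {V₁ E₁ V₂ E₂} → IsHypergraph V₁ E₁ → IsHypergraph V₂ E₂ → Disjoint V₁ V₂ →
                  IsHypergraph (V₁ ++ V₂) (E₁ ++ E₂)
IsHypergraph-++ {V₁} {E₁} {V₂} {E₂} h₁ h₂ disj = record
  { edges-unique       = Allₚ.++⁺ (edges-unique h₁) (edges-unique h₂)
  ; edges-incomparable = AllPairsₚ.++⁺ (edges-incomparable h₁) (edges-incomparable h₂)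
                           (All.tabulate λ a∈ → All.tabulate λ b∈ → across a∈ b∈)
  ; edges-⊆            = Allₚ.++⁺ (All.map (λ a⊆ {x} → ⊆ₚ.xs⊆xs++ys V₁ V₂ ∘ a⊆ {x}) (edges-⊆ h₁))
                                  (All.map (λ b⊆ {x} → ⊆ₚ.xs⊆ys++xs V₂ V₁ ∘ b⊆ {x}) (edges-⊆ h₂))
  ; edges-size         = Allₚ.++⁺ (edges-size h₁) (edges-size h₂)
  }
  where
  across : ∀ {a b} → a ∈ E₁ → b ∈ E₂ → Incomparable a b
  across a∈ b∈ =
    (λ a⊆b → let x , x∈a = 2≤length⇒nonempty (All.lookup (edges-size h₁) a∈) in
       disj x (All.lookup (edges-⊆ h₁) a∈ x∈a) (All.lookup (edges-⊆ h₂) b∈ (a⊆b x∈a))) ,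
    (λ b⊆a → let x , x∈b = 2≤length⇒nonempty (All.lookup (edges-size h₂) b∈) in
       disj x (All.lookup (edges-⊆ h₁) a∈ (b⊆a x∈b)) (All.lookup (edges-⊆ h₂) b∈ x∈b))

-- ψ does not depend on the fuel, nor on how the sets are listed

-- Definitionally the local step function of ψ-fuel.
ψ-fuel-step : ℕ → List ℕ → List ℕ × List (List ℕ) → ℕ∞
ψ-fuel-step k V (F , rest) =
  min∞ (ψ-fuel k V rest) (ψ-fuel k (colonV V F rest) (colonE F rest) +∞ fin (length F ∸ 1))

ψ-fuel-irrelevant : ∀ n m V E → length E ≤ n → length E ≤ m → ψ-fuel n V E ≡ ψ-fuel m V E
ψ-fuel-irrelevant _ _ [] _ _ _ = refl
ψ-fuel-irrelevant (suc n) m (v ∷ V) [] _ _ = refl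
ψ-fuel-irrelevant zero zero (v ∷ V) [] _ _ = refl
ψ-fuel-irrelevant zero (suc m) (v ∷ V) [] _ _ = refl
ψ-fuel-irrelevant (suc n) (suc m) (v ∷ V) (e ∷ E) ≤n ≤m =
  maxList-cong _ _ (picks (e ∷ E)) (picks (e ∷ E)) (λ p∈ → _ , p∈ , same p∈) (λ p∈ → _ , p∈ , same p∈)
  where
  same : ∀ {p} → p ∈ picks (e ∷ E) → ψ-fuel-step n (v ∷ V) p ≡ ψ-fuel-step m (v ∷ V) p
  same {F , r} p∈ = cong₂ min∞
    (ψ-fuel-irrelevant n m (v ∷ V) r r≤n r≤m)
    (cong (_+∞ fin (length F ∸ 1)) (ψ-fuel-irrelevant n m (colonV (v ∷ V) F r) (colonE F r)
      (ℕₚ.≤-trans (length-colonE F r) r≤n) (ℕₚ.≤-trans (length-colonE F r) r≤m)))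
    where
    r≤n = picks-length-≤ (e ∷ E) p∈ ≤n
    r≤m = picks-length-≤ (e ∷ E) p∈ ≤m

ψ-step : List ℕ → List ℕ × List (List ℕ) → ℕ∞
ψ-step V (F , rest) =
  min∞ (ψ (hg V rest)) (ψ (hg (colonV V F rest) (colonE F rest)) +∞ fin (length F ∸ 1))

ψ-unfold : ∀ v vs e es → ψ (hg (v ∷ vs) (e ∷ es)) ≡ maxList (map (ψ-step (v ∷ vs)) (picks (e ∷ es)))
ψ-unfold v vs e es =
  maxList-cong _ _ (picks (e ∷ es)) (picks (e ∷ es)) (λ p∈ → _ , p∈ , same p∈) (λ p∈ → _ , p∈ , same p∈)
  where
  same : ∀ {p} → p ∈ picks (e ∷ es) → ψ-fuel-step (length es) (v ∷ vs) p ≡ ψ-step (v ∷ vs) p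
  same {F , r} p∈ = cong₂ min∞
    (ψ-fuel-irrelevant (length es) (length r) (v ∷ vs) r r≤ ℕₚ.≤-refl)
    (cong (_+∞ fin (length F ∸ 1)) (ψ-fuel-irrelevant (length es) _ (colonV (v ∷ vs) F r) (colonE F r)
      (ℕₚ.≤-trans (length-colonE F r) r≤) ℕₚ.≤-refl))
    where
    r≤ = picks-length-≤ (e ∷ es) p∈ ℕₚ.≤-refl

ψ-step-upper : ∀ v vs E {p} → p ∈ picks E → ψ-step (v ∷ vs) p ≤∞ ψ (hg (v ∷ vs) E)
ψ-step-upper v vs (e ∷ es) p∈ =
  subst (_ ≤∞_) (sym (ψ-unfold v vs e es)) (maxList-upper (ψ-step (v ∷ vs)) p∈)

ψ-attained : ∀ v vs e es → ∃ λ p → p ∈ picks (e ∷ es) × ψ (hg (v ∷ vs) (e ∷ es)) ≡ ψ-step (v ∷ vs) p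
ψ-attained v vs e es with maxList-attained (ψ-step (v ∷ vs)) (e , es) (map _ (picks es))
... | p , p∈ , eq = p , p∈ , trans (ψ-unfold v vs e es) eq

record Equivalent (V : List ℕ) (E : List (List ℕ)) (V′ : List ℕ) (E′ : List (List ℕ)) : Set where
  field
    vertices-≋ : V ≋ V′
    unique     : All Unique E
    unique′    : All Unique E′
    distinct   : Distinct E
    distinct′  : Distinct E′
    to         : Matched E E′
    from       : Matched E′ E
open Equivalent

Equivalent-sym : ∀ {V E V′ E′} → Equivalent V E V′ E′ → Equivalent V′ E′ V E
Equivalent-sym eq = record
  { vertices-≋ = ≋-sym (vertices-≋ eq)
  ; unique = unique′ eq ; unique′ = unique eq
  ; distinct = distinct′ eq ; distinct′ = distinct eq
  ; to = from eq ; from = to eq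
  }

rest-Matched : ∀ {E E′ F F′ r r′} → Matched E E′ → F ≋ F′ →
               (F , r) ∈ picks E → (F′ , r′) ∈ picks E′ → All (λ S → ¬ (F ≋ S)) r → Matched r r′
rest-Matched {E} {E′} match F≋F′ p∈ p′∈ F≉ S∈ with match (picks-rest-⊆ E p∈ S∈)
... | S′ , S′∈ , S≋S′ with picks-split E′ p′∈ S′∈
... | inj₁ refl = ⊥-elim (All.lookup F≉ S∈ (≋-trans F≋F′ (≋-sym S≋S′)))
... | inj₂ S′∈r′ = S′ , S′∈r′ , S≋S′

colon-Equivalent : ∀ {V V′ F F′ r r′} → V ≋ V′ → F ≋ F′ → All Unique r → All Unique r′ →
                   Matched r r′ → Matched r′ r →
                   Equivalent (colonV V F r) (colonE F r) (colonV V′ F′ r′) (colonE F′ r′)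
colon-Equivalent {F = F} {F′} {r} {r′} V≋V′ F≋F′ u u′ r→r′ r′→r = record
  { vertices-≋ = ∖-resp-≋ V≋V′ (++-resp-≋ F≋F′ (N⊆N′ , N′⊆N))
  ; unique = colonE-Unique F r u
  ; unique′ = colonE-Unique F′ r′ u′
  ; distinct = minimalSets-Distinct (colonCandidates F r)
  ; distinct′ = minimalSets-Distinct (colonCandidates F′ r′)
  ; to = minimalSets-Matched to′ from′
  ; from = minimalSets-Matched from′ to′
  }
  where
  N⊆N′ = nbhd-Matched u u′ r→r′ F≋F′
  N′⊆N = nbhd-Matched u′ u r′→r (≋-sym F≋F′)
  to′ = colonCandidates-Matched u u′ r→r′ F≋F′ N′⊆N
  from′ = colonCandidates-Matched u′ u r′→r (≋-sym F≋F′) N⊆N′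

Equivalent-picks : ∀ {V E V′ E′ F r} → Equivalent V E V′ E′ → (F , r) ∈ picks E →
  ∃₂ λ F′ r′ → (F′ , r′) ∈ picks E′ × length F ≡ length F′ × Equivalent V r V′ r′ ×
               Equivalent (colonV V F r) (colonE F r) (colonV V′ F′ r′) (colonE F′ r′)
Equivalent-picks {V} {E} {V′} {E′} {F} {r} eq p∈ with to eq (picks-elem-∈ E p∈)
... | F′ , F′∈ , F≋F′ with picks-complete F′∈
... | r′ , p′∈ =
  F′ , r′ , p′∈ ,
  length-≋ (All.lookup (unique eq) (picks-elem-∈ E p∈)) (All.lookup (unique′ eq) F′∈) F≋F′ ,
  rest-eq , colon-Equivalent (vertices-≋ eq) F≋F′ (unique rest-eq) (unique′ rest-eq) (to rest-eq) (from rest-eq)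
  where
  F≉r = picks-AllPairs (λ x≉y → x≉y ∘ ≋-sym) (distinct eq) p∈
  F′≉r′ = picks-AllPairs (λ x≉y → x≉y ∘ ≋-sym) (distinct′ eq) p′∈
  rest-eq : Equivalent V r V′ r′
  rest-eq = record
    { vertices-≋ = vertices-≋ eq
    ; unique = proj₂ (picks-All (unique eq) p∈)
    ; unique′ = proj₂ (picks-All (unique′ eq) p′∈)
    ; distinct = proj₂ F≉r
    ; distinct′ = proj₂ F′≉r′
    ; to = rest-Matched (to eq) F≋F′ p∈ p′∈ (proj₁ F≉r)
    ; from = rest-Matched (from eq) (≋-sym F≋F′) p′∈ p∈ (proj₁ F′≉r′)
    }

ψ-fuel-resp-Equivalent : ∀ n V E V′ E′ → Equivalent V E V′ E′ → length E ≤ n → length E′ ≤ n →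
                         ψ-fuel n V E ≡ ψ-fuel n V′ E′
ψ-fuel-resp-Equivalent n [] E [] E′ eq _ _ = refl
ψ-fuel-resp-Equivalent n [] E (v ∷ V′) E′ eq _ _ with proj₂ (vertices-≋ eq) (here refl)
... | ()
ψ-fuel-resp-Equivalent n (v ∷ V) E [] E′ eq _ _ with proj₁ (vertices-≋ eq) (here refl)
... | ()
ψ-fuel-resp-Equivalent n (v ∷ V) [] (v′ ∷ V′) (e′ ∷ E′) eq _ _ with from eq (here refl)
... | _ , () , _
ψ-fuel-resp-Equivalent n (v ∷ V) (e ∷ E) (v′ ∷ V′) [] eq _ _ with to eq (here refl)
... | _ , () , _
ψ-fuel-resp-Equivalent zero (v ∷ V) [] (v′ ∷ V′) [] eq _ _ = refl
ψ-fuel-resp-Equivalent (suc n) (v ∷ V) [] (v′ ∷ V′) [] eq _ _ = refl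
ψ-fuel-resp-Equivalent (suc k) (v ∷ V) (e ∷ E) (v′ ∷ V′) (e′ ∷ E′) eq ≤n ≤n′ =
  maxList-cong _ _ (picks (e ∷ E)) (picks (e′ ∷ E′)) forth back
  where
  step-resp : ∀ {V E V′ E′ p} → Equivalent V E V′ E′ → length E ≤ suc k → length E′ ≤ suc k →
              p ∈ picks E → ∃ λ p′ → p′ ∈ picks E′ × ψ-fuel-step k V p ≡ ψ-fuel-step k V′ p′
  step-resp {E = E} {E′ = E′} {p = F , r} eq ≤n ≤n′ p∈ with Equivalent-picks eq p∈
  ... | F′ , r′ , p′∈ , |F|≡|F′| , rest-eq , colon-eq = (F′ , r′) , p′∈ ,
    cong₂ min∞ (ψ-fuel-resp-Equivalent k _ r _ r′ rest-eq r≤ r′≤)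
      (cong₂ _+∞_ (ψ-fuel-resp-Equivalent k _ (colonE F r) _ (colonE F′ r′) colon-eq
                    (ℕₚ.≤-trans (length-colonE F r) r≤) (ℕₚ.≤-trans (length-colonE F′ r′) r′≤))
                  (cong (λ l → fin (l ∸ 1)) |F|≡|F′|))
    where
    r≤ = picks-length-≤ E p∈ ≤n
    r′≤ = picks-length-≤ E′ p′∈ ≤n′
  forth : ∀ {p} → p ∈ picks (e ∷ E) →
          ∃ λ p′ → p′ ∈ picks (e′ ∷ E′) × ψ-fuel-step k (v ∷ V) p ≡ ψ-fuel-step k (v′ ∷ V′) p′
  forth = step-resp eq ≤n ≤n′
  back : ∀ {p′} → p′ ∈ picks (e′ ∷ E′) →
         ∃ λ p → p ∈ picks (e ∷ E) × ψ-fuel-step k (v ∷ V) p ≡ ψ-fuel-step k (v′ ∷ V′) p′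
  back p′∈ = let p , p∈ , same = step-resp (Equivalent-sym eq) ≤n′ ≤n p′∈ in p , p∈ , sym same

ψ-resp-Equivalent : ∀ {V E V′ E′} → Equivalent V E V′ E′ → ψ (hg V E) ≡ ψ (hg V′ E′)
ψ-resp-Equivalent {V} {E} {V′} {E′} eq = begin
  ψ-fuel (length E) V E    ≡⟨ ψ-fuel-irrelevant _ n V E ℕₚ.≤-refl E≤n ⟩
  ψ-fuel n V E             ≡⟨ ψ-fuel-resp-Equivalent n V E V′ E′ eq E≤n E′≤n ⟩
  ψ-fuel n V′ E′           ≡⟨ ψ-fuel-irrelevant n _ V′ E′ E′≤n ℕₚ.≤-refl ⟩
  ψ-fuel (length E′) V′ E′ ∎
  where
  open ≡-Reasoning
  n = length E + length E′
  E≤n = ℕₚ.m≤m+n (length E) (length E′)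
  E′≤n = ℕₚ.m≤n+m (length E′) (length E)

module ColonOfDisjointUnion
  {Va Ea Vb Eb F ra} (ha : IsHypergraph Va Ea) (hb : IsHypergraph Vb Eb) (disj : Disjoint Va Vb)
  (p∈ : (F , ra) ∈ picks Ea)
  {rest} (rest-∪ : IsUnion rest ra Eb)
  where

  private
    rest⁻ = proj₁ rest-∪
    rest⁺ = proj₂ rest-∪

    hra = IsHypergraph-rest ha p∈

    F⊆Va : F ⊆ Va
    F⊆Va = All.lookup (edges-⊆ ha) (picks-elem-∈ Ea p∈)

    Eb-∖F : ∀ {S} → S ∈ Eb → S ∖ F ≋ S
    Eb-∖F S∈ = ∖-⊆ _ F , λ x∈S → ∈-∖⁺ _ F x∈S λ x∈F →
      disj _ (F⊆Va x∈F) (All.lookup (edges-⊆ hb) S∈ x∈S)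

    Eb-length-∖F : ∀ {S} → S ∈ Eb → length (S ∖ F) ≡ length S
    Eb-length-∖F S∈ =
      length-≋ (Unique-∖ F (All.lookup (edges-unique hb) S∈)) (All.lookup (edges-unique hb) S∈) (Eb-∖F S∈)

    Eb-size-∖F : ∀ {S} → S ∈ Eb → 2 ≤ length (S ∖ F)
    Eb-size-∖F S∈ = subst (2 ≤_) (sym (Eb-length-∖F S∈)) (All.lookup (edges-size hb) S∈)

    rest-unique : All Unique rest
    rest-unique = All.tabulate
      ([ All.lookup (edges-unique hra) , All.lookup (edges-unique hb) ]′ ∘ rest⁻)

    -- Edges of the other component stay of size ≥ 2 after removing F, so only ra contributes to the neighbourhood.
    nbhd-rest⊆ : nbhd F rest ⊆ nbhd F ra
    nbhd-rest⊆ x∈ with ∈-nbhd⁻ F rest x∈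
    ... | S , S∈ , |S∖F|≡1 , x∈S∖F with rest⁻ S∈
    ... | inj₁ S∈ra = ∈-nbhd⁺ F ra S∈ra |S∖F|≡1 x∈S∖F
    ... | inj₂ S∈Eb = ⊥-elim (ℕₚ.<⇒≢ (subst (2 ≤_) |S∖F|≡1 (Eb-size-∖F S∈Eb)) refl)

    nbhd-ra⊆ : nbhd F ra ⊆ nbhd F rest
    nbhd-ra⊆ x∈ with ∈-nbhd⁻ F ra x∈
    ... | S , S∈ , |S∖F|≡1 , x∈S∖F = ∈-nbhd⁺ F rest (rest⁺ (inj₁ S∈)) |S∖F|≡1 x∈S∖F

    nbhd-ra⊆Va : nbhd F ra ⊆ Va
    nbhd-ra⊆Va x∈ with ∈-nbhd⁻ F ra x∈
    ... | S , S∈ , _ , x∈S∖F = All.lookup (edges-⊆ hra) S∈ (∖-⊆ S F x∈S∖F)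

    candidates-ra⊆ : ∀ {U} → U ∈ colonCandidates F ra → U ∈ colonCandidates F rest
    candidates-ra⊆ {U} U∈ with ∈-colonCandidates⁻ F ra U∈
    ... | R , R∈ , refl , t = ∈-colonCandidates⁺ F rest (rest⁺ (inj₁ R∈))
                                (colonCandidate-antitone {F} {rest} {ra} {U} nbhd-rest⊆ t)

    candidate-cases : ∀ {U} → U ∈ colonCandidates F rest →
                      U ∈ colonCandidates F ra ⊎ (∃ λ R → R ∈ Eb × U ≡ R ∖ F)
    candidate-cases {U} U∈ with ∈-colonCandidates⁻ F rest U∈
    ... | R , R∈ , refl , t with rest⁻ R∈
    ... | inj₁ R∈ra = inj₁ (∈-colonCandidates⁺ F ra R∈ra
                             (colonCandidate-antitone {F} {ra} {rest} {U} nbhd-ra⊆ t))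
    ... | inj₂ R∈Eb = inj₂ (R , R∈Eb , refl)

    candidate-ra⊆Va : ∀ {U} → U ∈ colonCandidates F ra → U ⊆ Va
    candidate-ra⊆Va U∈ x∈ with ∈-colonCandidates⁻ F ra U∈
    ... | R , R∈ , refl , _ = All.lookup (edges-⊆ hra) R∈ (∖-⊆ R F x∈)

    candidate-ra-nonempty : ∀ {U} → U ∈ colonCandidates F ra → ∃ λ x → x ∈ U
    candidate-ra-nonempty {U} U∈ with ∈-colonCandidates⁻ F ra U∈
    ... | R , _ , refl , t = 2≤length⇒nonempty (colonCandidate-length {F} {ra} {R ∖ F} t)

    Eb-candidate : ∀ {S} → S ∈ Eb → S ∖ F ∈ colonCandidates F rest
    Eb-candidate {S} S∈ = ∈-colonCandidates⁺ F rest (rest⁺ (inj₂ S∈))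
      (T-∧⁺ (ℕₚ.<⇒<ᵇ (Eb-size-∖F S∈)) (T-not⁺ λ m →
        let _ , x∈ , x∈N = meets⁻ (S ∖ F) (nbhd F rest) m in
        disj _ (nbhd-ra⊆Va (nbhd-rest⊆ x∈N)) (All.lookup (edges-⊆ hb) S∈ (∖-⊆ S F x∈))))

    minimal-from-ra : ∀ {S} → MinimalIn (colonCandidates F ra) S → MinimalIn (colonCandidates F rest) S
    minimal-from-ra {S} (S∈ , S-min) = candidates-ra⊆ S∈ , λ U∈ U⊂S →
      [ (λ U∈ra → S-min U∈ra U⊂S) , from-Eb U⊂S ]′ (candidate-cases U∈)
      where
      from-Eb : ∀ {U} → U ⊂ S → ¬ (∃ λ R → R ∈ Eb × U ≡ R ∖ F)
      from-Eb (U⊆S , _) (R , R∈ , refl) =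
        let x , x∈ = 2≤length⇒nonempty (Eb-size-∖F R∈) in
        disj _ (candidate-ra⊆Va S∈ (U⊆S x∈)) (All.lookup (edges-⊆ hb) R∈ (∖-⊆ R F x∈))

    minimal-from-Eb : ∀ {S} → S ∈ Eb → MinimalIn (colonCandidates F rest) (S ∖ F)
    minimal-from-Eb {S} S∈ = Eb-candidate S∈ , λ U∈ U⊂ → [ from-ra U⊂ , from-Eb U⊂ ]′ (candidate-cases U∈)
      where
      from-ra : ∀ {U} → U ⊂ S ∖ F → ¬ (U ∈ colonCandidates F ra)
      from-ra (U⊆ , _) U∈ = let x , x∈ = candidate-ra-nonempty U∈ in
        disj _ (candidate-ra⊆Va U∈ x∈) (All.lookup (edges-⊆ hb) S∈ (∖-⊆ S F (U⊆ x∈)))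
      from-Eb : ∀ {U} → U ⊂ S ∖ F → ¬ (∃ λ R → R ∈ Eb × U ≡ R ∖ F)
      from-Eb (U⊆ , ⊉U) (R , R∈ , refl) with AllPairs-∈ Incomparable-sym (edges-incomparable hb) R∈ S∈
      ... | inj₁ refl = ⊉U (λ x∈ → x∈)
      ... | inj₂ (R⊈S , _) = R⊈S (∖-⊆ S F ∘ U⊆ ∘ proj₂ (Eb-∖F R∈))

    colon-≋ : ∀ {V W} → V ≋ Va ++ Vb → W ≋ colonV Va F ra ++ Vb → colonV V F rest ≋ W
    colon-≋ {V} {W} V≋ W≋ = proj₂ W≋ ∘ forth , back ∘ proj₁ W≋
      where
      forth : ∀ {x} → x ∈ colonV V F rest → x ∈ colonV Va F ra ++ Vb
      forth x∈ with ∈-colonV⁻ V F rest x∈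
      ... | x∈V , x∉F , x∉N with ∈ₚ.∈-++⁻ Va (proj₁ V≋ x∈V)
      ... | inj₁ x∈Va = ∈ₚ.∈-++⁺ˡ (∈-colonV⁺ Va F ra x∈Va x∉F (x∉N ∘ nbhd-ra⊆))
      ... | inj₂ x∈Vb = ∈ₚ.∈-++⁺ʳ (colonV Va F ra) x∈Vb
      back : ∀ {x} → x ∈ colonV Va F ra ++ Vb → x ∈ colonV V F rest
      back x∈ with ∈ₚ.∈-++⁻ (colonV Va F ra) x∈
      ... | inj₁ x∈colon = let x∈Va , x∉F , x∉N = ∈-colonV⁻ Va F ra x∈colon in
        ∈-colonV⁺ V F rest (proj₂ V≋ (∈ₚ.∈-++⁺ˡ x∈Va)) x∉F (x∉N ∘ nbhd-rest⊆)
      ... | inj₂ x∈Vb = ∈-colonV⁺ V F rest (proj₂ V≋ (∈ₚ.∈-++⁺ʳ Va x∈Vb))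
        (λ x∈F → disj _ (F⊆Va x∈F) x∈Vb) (λ x∈N → disj _ (nbhd-ra⊆Va (nbhd-rest⊆ x∈N)) x∈Vb)

    colon-Matched : ∀ {E′} → IsUnion E′ (colonE F ra) Eb → Matched (colonE F rest) E′
    colon-Matched E′-∪ S∈ with ∈-minimalSets⁻ (colonCandidates F rest) S∈
    ... | S∈cand , S-min with candidate-cases S∈cand
    ... | inj₂ (R , R∈ , refl) = R , proj₂ E′-∪ (inj₂ R∈) , Eb-∖F R∈
    ... | inj₁ S∈ra with ∈-minimalSets⁺ (colonCandidates F ra) (S∈ra , λ U∈ → S-min (candidates-ra⊆ U∈))
    ... | S′ , S′∈ , S′≋S = S′ , proj₂ E′-∪ (inj₁ S′∈) , ≋-sym S′≋S

    colon-Matched⁻ : ∀ {E′} → IsUnion E′ (colonE F ra) Eb → Matched E′ (colonE F rest)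
    colon-Matched⁻ E′-∪ S∈ with proj₁ E′-∪ S∈
    ... | inj₁ S∈ra =
      let S′ , S′∈ , S′≋S = ∈-minimalSets⁺ (colonCandidates F rest)
                               (minimal-from-ra (∈-minimalSets⁻ (colonCandidates F ra) S∈ra)) in
      S′ , S′∈ , ≋-sym S′≋S
    ... | inj₂ S∈Eb =
      let S′ , S′∈ , S′≋ = ∈-minimalSets⁺ (colonCandidates F rest) (minimal-from-Eb S∈Eb) in
      S′ , S′∈ , ≋-trans (≋-sym (Eb-∖F S∈Eb)) (≋-sym S′≋)

  colon-Equivalent-∪ : ∀ {V W E′} → V ≋ Va ++ Vb → W ≋ colonV Va F ra ++ Vb →
    IsUnion E′ (colonE F ra) Eb → All Unique E′ → Distinct E′ →
    Equivalent (colonV V F rest) (colonE F rest) W E′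
  colon-Equivalent-∪ V≋ W≋ E′-∪ u′ d′ = record
    { vertices-≋ = colon-≋ V≋ W≋
    ; unique = colonE-Unique F rest rest-unique
    ; unique′ = u′
    ; distinct = minimalSets-Distinct (colonCandidates F rest)
    ; distinct′ = d′
    ; to = colon-Matched E′-∪
    ; from = colon-Matched⁻ E′-∪
    }

-- ψ is additive on disjoint unions

AdditiveUpTo : ℕ → Set
AdditiveUpTo n = ∀ {V₁ E₁ V₂ E₂} → IsHypergraph V₁ E₁ → IsHypergraph V₂ E₂ → Disjoint V₁ V₂ →
  length E₁ + length E₂ ≤ n → ψ (hg (V₁ ++ V₂) (E₁ ++ E₂)) ≡ ψ (hg V₁ E₁) +∞ ψ (hg V₂ E₂)

module AdditivityStep
  (k : ℕ) (IH : AdditiveUpTo k)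
  {v₁ V₁′ E₁ v₂ V₂′ E₂} (h₁ : IsHypergraph (v₁ ∷ V₁′) E₁) (h₂ : IsHypergraph (v₂ ∷ V₂′) E₂)
  (disj : Disjoint (v₁ ∷ V₁′) (v₂ ∷ V₂′)) (≤suc-k : length E₁ + length E₂ ≤ suc k)
  where

  private
    V₁ = v₁ ∷ V₁′
    V₂ = v₂ ∷ V₂′
    V = V₁ ++ V₂
    ψ₁ = ψ (hg V₁ E₁)
    ψ₂ = ψ (hg V₂ E₂)

    step-left : ∀ {F r₁} → (F , r₁) ∈ picks E₁ → ψ-step V (F , r₁ ++ E₂) ≡ ψ-step V₁ (F , r₁) +∞ ψ₂
    step-left {F} {r₁} p∈ = trans
      (cong₂ (λ a b → min∞ a (b +∞ fin (length F ∸ 1))) (IH (IsHypergraph-rest h₁ p∈) h₂ disj r≤) colon-ψ)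
      (min∞-step-+∞ʳ (ψ (hg V₁ r₁)) (ψ (hg cV cE)) (fin (length F ∸ 1)) ψ₂)
      where
      cV = colonV V₁ F r₁
      cE = colonE F r₁
      r≤ : length r₁ + length E₂ ≤ k
      r≤ = ℕₚ.≤-pred (subst (λ l → l + length E₂ ≤ suc k) (sym (picks-length E₁ p∈)) ≤suc-k)
      disj′ : Disjoint cV V₂
      disj′ x = disj x ∘ proj₁ ∘ ∈-colonV⁻ V₁ F r₁
      hc = IsHypergraph-colon h₁ p∈
      h = IsHypergraph-++ hc h₂ disj′
      open ColonOfDisjointUnion h₁ h₂ disj p∈ (++-IsUnion r₁ E₂)
      colon-ψ : ψ (hg (colonV V F (r₁ ++ E₂)) (colonE F (r₁ ++ E₂))) ≡ ψ (hg cV cE) +∞ ψ₂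
      colon-ψ = trans
        (ψ-resp-Equivalent (colon-Equivalent-∪ ≋-refl ≋-refl (++-IsUnion cE E₂)
                                                 (edges-unique h) (edges-Distinct h)))
        (IH hc h₂ disj′ (ℕₚ.≤-trans (ℕₚ.+-monoˡ-≤ (length E₂) (length-colonE F r₁)) r≤))

    step-right : ∀ {F r₂} → (F , r₂) ∈ picks E₂ → ψ-step V (F , E₁ ++ r₂) ≡ ψ₁ +∞ ψ-step V₂ (F , r₂)
    step-right {F} {r₂} p∈ = trans
      (cong₂ (λ a b → min∞ a (b +∞ fin (length F ∸ 1))) (IH h₁ (IsHypergraph-rest h₂ p∈) disj r≤) colon-ψ)
      (min∞-step-+∞ˡ (ψ (hg V₂ r₂)) (ψ (hg cV cE)) (fin (length F ∸ 1)) ψ₁)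
      where
      cV = colonV V₂ F r₂
      cE = colonE F r₂
      r≤ : length E₁ + length r₂ ≤ k
      r≤ = ℕₚ.≤-pred (subst (_≤ suc k)
             (trans (cong (length E₁ +_) (sym (picks-length E₂ p∈))) (ℕₚ.+-suc (length E₁) (length r₂)))
             ≤suc-k)
      disj′ : Disjoint V₁ cV
      disj′ x x∈V₁ = disj x x∈V₁ ∘ proj₁ ∘ ∈-colonV⁻ V₂ F r₂
      hc = IsHypergraph-colon h₂ p∈
      h = IsHypergraph-++ h₁ hc disj′
      open ColonOfDisjointUnion h₂ h₁ (λ x x∈V₂ x∈V₁ → disj x x∈V₁ x∈V₂) p∈ (++-IsUnion-swap r₂ E₁)
      colon-ψ : ψ (hg (colonV V F (E₁ ++ r₂)) (colonE F (E₁ ++ r₂))) ≡ ψ₁ +∞ ψ (hg cV cE)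
      colon-ψ = trans
        (ψ-resp-Equivalent (colon-Equivalent-∪ (++-comm-≋ V₁ V₂) (++-comm-≋ V₁ cV) (++-IsUnion-swap cE E₁)
                                                 (edges-unique h) (edges-Distinct h)))
        (IH h₁ hc disj′ (ℕₚ.≤-trans (ℕₚ.+-monoʳ-≤ (length E₁) (length-colonE F r₂)) r≤))

  M : ℕ∞
  M = maxList (map (ψ-step V) (picks (E₁ ++ E₂)))

  upper : M ≤∞ ψ₁ +∞ ψ₂
  upper = maxList-lub (ψ-step V) (picks (E₁ ++ E₂)) bound
    where
    bound : ∀ {p} → p ∈ picks (E₁ ++ E₂) → ψ-step V p ≤∞ ψ₁ +∞ ψ₂
    bound {F , _} p∈ with picks-++⁻ E₁ E₂ p∈
    ... | inj₁ (r₁ , p∈₁ , refl) =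
      subst (_≤∞ _) (sym (step-left p∈₁)) (+∞-monoˡ-≤∞ ψ₂ (ψ-step-upper v₁ V₁′ E₁ p∈₁))
    ... | inj₂ (r₂ , p∈₂ , refl) =
      subst (_≤∞ _) (sym (step-right p∈₂)) (+∞-monoʳ-≤∞ ψ₁ (ψ-step-upper v₂ V₂′ E₂ p∈₂))

  lower : ∀ {F r₁} → (F , r₁) ∈ picks E₁ → ψ₁ ≡ ψ-step V₁ (F , r₁) → ψ₁ +∞ ψ₂ ≤∞ M
  lower p∈ ψ₁≡ =
    subst (_≤∞ M) (sym (trans (cong (_+∞ ψ₂) ψ₁≡) (sym (step-left p∈))))
      (maxList-upper (ψ-step V) (picks-++⁺ˡ E₁ E₂ p∈))

  -- With no edge on the left, ψ₁ = ∞ makes every step through the right component infinite.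
  lower-∞ : ψ₁ ≡ ∞ → ∀ {e} → e ∈ E₂ → ψ₁ +∞ ψ₂ ≤∞ M
  lower-∞ ψ₁≡∞ e∈ with picks-complete e∈
  ... | r₂ , p∈ =
    subst (_≤∞ M) (trans (step-right p∈) (trans (cong (_+∞ _) ψ₁≡∞) (sym (cong (_+∞ _) ψ₁≡∞))))
          (maxList-upper (ψ-step V) (picks-++⁺ʳ E₁ E₂ p∈))

edge⊈[] : ∀ {E} → IsHypergraph [] E → ∀ {e} → ¬ (e ∈ E)
edge⊈[] h e∈ with 2≤length⇒nonempty (All.lookup (edges-size h) e∈)
... | _ , x∈e with All.lookup (edges-⊆ h) e∈ x∈e
... | ()

ψ-additive : ∀ n → AdditiveUpTo n
ψ-additive n {[]} {[]} _ _ _ _ = sym (+∞-identityˡ _)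
ψ-additive n {[]} {e ∷ _} h₁ _ _ _ = ⊥-elim (edge⊈[] h₁ (here refl))
ψ-additive n {v ∷ V₁} {E₁} {[]} {[]} _ _ _ _ = begin
  ψ (hg ((v ∷ V₁) ++ []) (E₁ ++ []))
    ≡⟨ cong₂ (λ V E → ψ (hg V E)) (Listₚ.++-identityʳ (v ∷ V₁)) (Listₚ.++-identityʳ E₁) ⟩
  ψ (hg (v ∷ V₁) E₁)                  ≡⟨ +∞-identityʳ _ ⟨
  ψ (hg (v ∷ V₁) E₁) +∞ fin 0         ∎
  where open ≡-Reasoning
ψ-additive n {v ∷ _} {_} {[]} {e ∷ _} _ h₂ _ _ = ⊥-elim (edge⊈[] h₂ (here refl))
ψ-additive n {_ ∷ _} {[]} {_ ∷ _} {[]} _ _ _ _ = refl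
ψ-additive zero {_ ∷ _} {_ ∷ _} {_ ∷ _} {_} _ _ _ ()
ψ-additive zero {_ ∷ _} {[]} {_ ∷ _} {_ ∷ _} _ _ _ ()
ψ-additive (suc k) {v₁ ∷ V₁} {e ∷ E₁} {v₂ ∷ V₂} {E₂} h₁ h₂ disj ≤n with ψ-attained v₁ V₁ e E₁
... | _ , p∈ , ψ₁≡ = trans (ψ-unfold v₁ (V₁ ++ v₂ ∷ V₂) e (E₁ ++ E₂)) (≤∞-antisym upper (lower p∈ ψ₁≡))
  where open AdditivityStep k (ψ-additive k) h₁ h₂ disj ≤n
ψ-additive (suc k) {v₁ ∷ V₁} {[]} {v₂ ∷ V₂} {e ∷ E₂} h₁ h₂ disj ≤n =
  trans (ψ-unfold v₁ (V₁ ++ v₂ ∷ V₂) e E₂) (≤∞-antisym upper (lower-∞ refl (here refl)))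
  where open AdditivityStep k (ψ-additive k) h₁ h₂ disj ≤n

-- Minimal non-faces of the join of two independence complexes

AllPairs-map-All : ∀ {A : Set} {R Q : A → A → Set} {P : A → Set} {xs} →
                   (∀ {a b} → P a → P b → R a b → Q a b) → All P xs → AllPairs R xs → AllPairs Q xs
AllPairs-map-All f [] [] = []
AllPairs-map-All f (Px ∷ Pxs) (Rx ∷ Rxs) =
  All.zipWith (λ (Py , Rxy) → f Px Py Rxy) (Pxs , Rx) ∷ AllPairs-map-All f Pxs Rxs

∈-subsets⇒⊆ : ∀ V {S} → S ∈ subsets V → S ⊆ V
∈-subsets⇒⊆ [] (here refl) ()
∈-subsets⇒⊆ (x ∷ xs) S∈ with ∈ₚ.∈-++⁻ (subsets xs) S∈
... | inj₁ S∈′ = there ∘ ∈-subsets⇒⊆ xs S∈′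
... | inj₂ S∈map with ∈ₚ.∈-map⁻ (x ∷_) S∈map
... | S′ , S′∈ , refl = λ { (here y≡x) → here y≡x ; (there y∈) → there (∈-subsets⇒⊆ xs S′∈ y∈) }

subsets-Unique : ∀ V → Unique V → ∀ {S} → S ∈ subsets V → Unique S
subsets-Unique [] _ (here refl) = []
subsets-Unique (x ∷ xs) (x∉ ∷ u) S∈ with ∈ₚ.∈-++⁻ (subsets xs) S∈
... | inj₁ S∈′ = subsets-Unique xs u S∈′
... | inj₂ S∈map with ∈ₚ.∈-map⁻ (x ∷_) S∈map
... | S′ , S′∈ , refl = All.tabulate (All.lookup x∉ ∘ ∈-subsets⇒⊆ xs S′∈) ∷ subsets-Unique xs u S′∈

subsets-Distinct : ∀ V → Unique V → Distinct (subsets V)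
subsets-Distinct [] _ = [] ∷ []
subsets-Distinct (x ∷ xs) (x∉ ∷ u) =
  AllPairsₚ.++⁺ (subsets-Distinct xs u)
    (AllPairsₚ.map⁺ (AllPairs-map-All cons-≉ (All.tabulate (λ S∈ → S∈)) (subsets-Distinct xs u)))
    (All.tabulate λ a∈ → All.tabulate λ b∈ → without≉with a∈ b∈)
  where
  x∉subset : ∀ {a} → a ∈ subsets xs → x ∉ a
  x∉subset a∈ x∈a = All.lookup x∉ (∈-subsets⇒⊆ xs a∈ x∈a) refl
  uncons-⊆ : ∀ {c d} → c ∈ subsets xs → x ∷ c ⊆ x ∷ d → c ⊆ d
  uncons-⊆ c∈ s y∈ with s (there y∈)
  ... | here refl = ⊥-elim (x∉subset c∈ y∈)
  ... | there y∈d = y∈d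
  cons-≉ : ∀ {a b} → a ∈ subsets xs → b ∈ subsets xs → ¬ (a ≋ b) → ¬ (x ∷ a ≋ x ∷ b)
  cons-≉ a∈ b∈ a≉b (p , q) = a≉b (uncons-⊆ a∈ p , uncons-⊆ b∈ q)
  without≉with : ∀ {a b′} → a ∈ subsets xs → b′ ∈ map (x ∷_) (subsets xs) → ¬ (a ≋ b′)
  without≉with a∈ b′∈ (_ , b′⊆a) with ∈ₚ.∈-map⁻ (x ∷_) b′∈
  ... | b , b∈ , refl = x∉subset a∈ (b′⊆a (here refl))

filterᵇ-∈-subsets : ∀ (p : ℕ → Bool) V → filterᵇ p V ∈ subsets V
filterᵇ-∈-subsets p [] = here refl
filterᵇ-∈-subsets p (x ∷ xs) with T? (p x)
... | yes px rewrite Listₚ.filter-accept (T? ∘ p) {x} {xs} px =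
  ∈ₚ.∈-++⁺ʳ (subsets xs) (∈ₚ.∈-map⁺ (x ∷_) (filterᵇ-∈-subsets p xs))
... | no ¬px rewrite Listₚ.filter-reject (T? ∘ p) {x} {xs} ¬px = ∈ₚ.∈-++⁺ˡ (filterᵇ-∈-subsets p xs)

restrict-⊆ : ∀ S W → filterᵇ (_∈ᵇ W) S ⊆ S
restrict-⊆ S W = proj₁ ∘ ∈-filterᵇ⁻ (_∈ᵇ W) {xs = S}

restrict-⊆ʳ : ∀ S W → filterᵇ (_∈ᵇ W) S ⊆ W
restrict-⊆ʳ S W = ∈ᵇ⇒∈ W ∘ proj₂ ∘ ∈-filterᵇ⁻ (_∈ᵇ W) {xs = S}

⊆-restrict : ∀ {e S W} → e ⊆ S → e ⊆ W → e ⊆ filterᵇ (_∈ᵇ W) S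
⊆-restrict {W = W} e⊆S e⊆W y∈ = ∈-filterᵇ⁺ (_∈ᵇ W) (e⊆S y∈) (∈⇒∈ᵇ (e⊆W y∈))

Ind-face⁻ : ∀ C {S} → T (isFace (Ind C) S) → ∀ {e} → e ∈ edges C → ¬ (e ⊆ S)
Ind-face⁻ C {S} t e∈ e⊆S =
  T-not⁻ (T-∧⁻ʳ {S ⊆ᵇ vertices C} t) (Anyₚ.any⁺ (_⊆ᵇ S) (lose e∈ (⊆⇒⊆ᵇ e⊆S)))

Ind-face⁺ : ∀ C {S} → S ⊆ vertices C → (∀ {e} → e ∈ edges C → ¬ (e ⊆ S)) → T (isFace (Ind C) S)
Ind-face⁺ C {S} S⊆ no-edge = T-∧⁺ (⊆⇒⊆ᵇ S⊆) (T-not⁺ λ t →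
  let e , e∈ , e⊆ᵇS = find (Anyₚ.any⁻ (_⊆ᵇ S) (edges C) t) in no-edge e∈ (⊆ᵇ⇒⊆ e S e⊆ᵇS))

module _ (C₁ C₂ : Hypergraph) where

  private
    V₁ = vertices C₁
    V₂ = vertices C₂
    V = V₁ ++ V₂
    E = edges C₁ ++ edges C₂
    Δ = Ind C₁ * Ind C₂

  join-face⁻ : All (_⊆ V₁) (edges C₁) → All (_⊆ V₂) (edges C₂) →
               ∀ {S} → T (isFace Δ S) → ∀ {e} → e ∈ E → ¬ (e ⊆ S)
  join-face⁻ E₁⊆ E₂⊆ {S} t e∈ e⊆S with ∈ₚ.∈-++⁻ (edges C₁) e∈
  ... | inj₁ e∈₁ = Ind-face⁻ C₁ (T-∧⁻ˡ (T-∧⁻ʳ {S ⊆ᵇ V} t)) e∈₁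
                     (⊆-restrict e⊆S (All.lookup E₁⊆ e∈₁))
  ... | inj₂ e∈₂ = Ind-face⁻ C₂ (T-∧⁻ʳ {isFace (Ind C₁) (filterᵇ (_∈ᵇ V₁) S)} (T-∧⁻ʳ {S ⊆ᵇ V} t)) e∈₂
                     (⊆-restrict e⊆S (All.lookup E₂⊆ e∈₂))

  join-face⁺ : ∀ {S} → S ⊆ V → (∀ {e} → e ∈ E → ¬ (e ⊆ S)) → T (isFace Δ S)
  join-face⁺ {S} S⊆ no-edge = T-∧⁺ (⊆⇒⊆ᵇ S⊆) (T-∧⁺
    (Ind-face⁺ C₁ (restrict-⊆ʳ S V₁) λ e∈ e⊆ → no-edge (∈ₚ.∈-++⁺ˡ e∈) (restrict-⊆ S V₁ ∘ e⊆))
    (Ind-face⁺ C₂ (restrict-⊆ʳ S V₂) λ e∈ e⊆ → no-edge (∈ₚ.∈-++⁺ʳ (edges C₁) e∈) (restrict-⊆ S V₂ ∘ e⊆)))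

isMinimalNonFace : Complex → List ℕ → Bool
isMinimalNonFace Δ S = not (isFace Δ S) ∧ all (λ U → not (U ⊂ᵇ S) ∨ isFace Δ U) (subsets (cvertices Δ))

module _ (Δ : Complex) where

  private
    V = cvertices Δ

  ∈-minNonFaces⁻ : ∀ {S} → S ∈ edges (minNonFaces Δ) →
    S ∈ subsets V × ¬ T (isFace Δ S) × (∀ {U} → U ∈ subsets V → U ⊂ S → T (isFace Δ U))
  ∈-minNonFaces⁻ {S} S∈ with ∈-filterᵇ⁻ (isMinimalNonFace Δ) S∈
  ... | S∈subsets , t = S∈subsets , T-not⁻ (T-∧⁻ˡ t) , λ {U} U∈ U⊂S →
    [ (λ U⊄ᵇS → ⊥-elim (T-not⁻ U⊄ᵇS (⊂⇒⊂ᵇ U⊂S))) , (λ face → face) ]′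
      (T-∨⁻ (All.lookup (Allₚ.all⁺ _ (subsets V) (T-∧⁻ʳ {not (isFace Δ S)} t)) U∈))

  ∈-minNonFaces⁺ : ∀ {S} → S ∈ subsets V → ¬ T (isFace Δ S) →
    (∀ {U} → U ∈ subsets V → U ⊂ S → T (isFace Δ U)) → S ∈ edges (minNonFaces Δ)
  ∈-minNonFaces⁺ {S} S∈ non-face minimal = ∈-filterᵇ⁺ (isMinimalNonFace Δ) S∈
    (T-∧⁺ (T-not⁺ non-face) (Allₚ.all⁻ _ (All.tabulate λ {U} U∈ → case T? (U ⊂ᵇ S) of λ where
      (yes U⊂ᵇS) → T-∨⁺ʳ {not (U ⊂ᵇ S)} (minimal U∈ (⊂ᵇ⇒⊂ U S U⊂ᵇS))
      (no U⊄ᵇS) → T-∨⁺ˡ (T-not⁺ U⊄ᵇS))))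

module _ {C₁ C₂ : Hypergraph} (h₁ : IsHypergraph (vertices C₁) (edges C₁))
         (h₂ : IsHypergraph (vertices C₂) (edges C₂)) (disj : Disjoint (vertices C₁) (vertices C₂))
  where

  private
    V = vertices C₁ ++ vertices C₂
    E = edges C₁ ++ edges C₂
    Δ = Ind C₁ * Ind C₂
    h = IsHypergraph-++ h₁ h₂ disj
    face⁻ = join-face⁻ C₁ C₂ (edges-⊆ h₁) (edges-⊆ h₂)
    face⁺ = join-face⁺ C₁ C₂

    -- Among the subsets of V, an edge e is represented by the restriction of V to e.
    restrict-edge≋ : ∀ {e} → e ∈ E → filterᵇ (_∈ᵇ e) V ≋ e
    restrict-edge≋ e∈ = restrict-⊆ʳ V _ , ⊆-restrict (All.lookup (edges-⊆ h) e∈) (λ x∈ → x∈)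

    non-face-contains-edge : ∀ {S} → S ⊆ V → ¬ T (isFace Δ S) → ∃ λ e → e ∈ E × e ⊆ S
    non-face-contains-edge {S} S⊆ non-face with T? (any (_⊆ᵇ S) E)
    ... | yes t = let e , e∈ , e⊆ᵇS = find (Anyₚ.any⁻ (_⊆ᵇ S) E t) in e , e∈ , ⊆ᵇ⇒⊆ e S e⊆ᵇS
    ... | no ¬t = ⊥-elim (non-face (face⁺ S⊆ λ e∈ e⊆S → ¬t (Anyₚ.any⁺ (_⊆ᵇ S) (lose e∈ (⊆⇒⊆ᵇ e⊆S)))))

    minNonFaces-to : Matched (edges (minNonFaces Δ)) E
    minNonFaces-to {S} S∈ with ∈-minNonFaces⁻ Δ S∈
    ... | S∈subsets , non-face , minimal
      with non-face-contains-edge (∈-subsets⇒⊆ V S∈subsets) non-face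
    ... | e , e∈ , e⊆S with T? (S ⊆ᵇ e)
    ... | yes S⊆ᵇe = e , e∈ , ⊆ᵇ⇒⊆ S e S⊆ᵇe , e⊆S
    ... | no S⊈ᵇe = ⊥-elim (face⁻ (minimal (filterᵇ-∈-subsets (_∈ᵇ e) V) U⊂S) e∈ (proj₂ U≋e))
      where
      U≋e : filterᵇ (_∈ᵇ e) V ≋ e
      U≋e = restrict-edge≋ e∈
      U⊂S : filterᵇ (_∈ᵇ e) V ⊂ S
      U⊂S = (λ x∈ → e⊆S (proj₁ U≋e x∈)) , λ S⊆U → S⊈ᵇe (⊆⇒⊆ᵇ λ x∈ → proj₁ U≋e (S⊆U x∈))

    minNonFaces-from : Matched E (edges (minNonFaces Δ))
    minNonFaces-from {e} e∈ = S , S∈ , ≋-sym S≋e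
      where
      S = filterᵇ (_∈ᵇ e) V
      S≋e = restrict-edge≋ e∈
      below-is-face : ∀ {U} → U ∈ subsets V → U ⊂ S → T (isFace Δ U)
      below-is-face {U} U∈ (U⊆S , S⊈U) = face⁺ (∈-subsets⇒⊆ V U∈) λ {e′} e′∈ e′⊆U →
        [ (λ { refl → S⊈U (λ x∈ → e′⊆U (proj₁ S≋e x∈)) })
        , (λ incomparable → proj₁ incomparable λ x∈ → proj₁ S≋e (U⊆S (e′⊆U x∈))) ]′
          (AllPairs-∈ Incomparable-sym (edges-incomparable h) e′∈ e∈)
      S∈ : S ∈ edges (minNonFaces Δ)
      S∈ = ∈-minNonFaces⁺ Δ (filterᵇ-∈-subsets (_∈ᵇ e) V)
             (λ face → face⁻ face e∈ (proj₂ S≋e)) below-is-face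

  minNonFaces-join-Equivalent : Unique V → Equivalent V (edges (minNonFaces Δ)) V E
  minNonFaces-join-Equivalent uV = record
    { vertices-≋ = ≋-refl
    ; unique = All.tabulate (subsets-Unique V uV ∘ proj₁ ∘ ∈-filterᵇ⁻ (isMinimalNonFace Δ))
    ; unique′ = edges-unique h
    ; distinct = AllPairsₚ.filter⁺ (T? ∘ isMinimalNonFace Δ) (subsets-Distinct V uV)
    ; distinct′ = edges-Distinct h
    ; to = minNonFaces-to
    ; from = minNonFaces-from
    }

proposition3p5 : (C₁ C₂ : Hypergraph) → WF C₁ → WF C₂ →
                 Disjoint (vertices C₁) (vertices C₂) →
                 ψ (minNonFaces (Ind C₁ * Ind C₂)) ≡ ψ C₁ +∞ ψ C₂
proposition3p5 C₁ C₂ wf₁ wf₂ disj = begin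
  ψ (minNonFaces (Ind C₁ * Ind C₂))
    ≡⟨ ψ-resp-Equivalent (minNonFaces-join-Equivalent h₁ h₂ disj uV) ⟩
  ψ (hg (vertices C₁ ++ vertices C₂) (edges C₁ ++ edges C₂))
    ≡⟨ ψ-additive _ h₁ h₂ disj (ℕₚ.≤-reflexive (sym (Listₚ.length-++ (edges C₁) {edges C₂}))) ⟩
  ψ C₁ +∞ ψ C₂ ∎
  where
  open ≡-Reasoning
  h₁ = WF⇒IsHypergraph C₁ wf₁
  h₂ = WF⇒IsHypergraph C₂ wf₂
  uV = Uniqueₚ.++⁺ (WF.vertices-unique wf₁) (WF.vertices-unique wf₂) λ (x∈₁ , x∈₂) → disj _ x∈₁ x∈₂
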